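{- Let $T$ be a perfect tree with maximum degree $\Delta$, and let $k$ be an integer with $2\le k\le \mathrm{diam}(T)$. Then $$\mu_k(T)=\begin{cases}\Delta\,(\Delta-1)^{\frac{k-2}{2}} & \text{if } k \text{ is even},\\ 2\,(\Delta-1)^{\frac{k-1}{2}} & \text{if } k \text{ is odd}.\end{cases}$$
   Context: A tree $T$ is complete if for every leaf $i$ of $T$ there is a leaf $j$ with $d_T(i,j)=\mathrm{diam}(T)$. A perfect tree is a complete tree in which all non-leaf vertices have the same degree. For a graph $G$, a set $S\subseteq V(G)$ and an integer $k\ge 1$, two vertices $x,y$ are $S_k$-visible if there is a shortest $x,y$-path of length at most $k$ none of whose internal vertices lies in $S$. $S$ is a $k$-distance mutual-visibility set if every two vertices of $S$ are $S_k$-visible, and $\mu_k(G)$ is the maximum cardinality of such a set. -}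

module Defs where

open import Data.Nat using (ℕ; zero; suc; _≤_; _∸_; _*_; _^_; _/_; _%_)
open import Data.Bool using (Bool; true; false; T)
open import Data.Fin using (Fin)
open import Data.Fin.Subset using (Subset; _∈_; ∣_∣)
open import Data.Vec using (tabulate)
open import Data.List using (List; []; _∷_)
open import Data.List.Relation.Unary.Unique.Propositional using (Unique)
open import Data.Product using (Σ; ∃; ∃-syntax; _×_)
open import Data.Unit using (⊤)
open import Relation.Nullary using (¬_)
open import Relation.Binary.PropositionalEquality using (_≡_; _≢_)

record Graph : Set where
  field
    n      : ℕ
    adj    : Fin n → Fin n → Bool
    sym    : ∀ x y → adj x y ≡ adj y x
    irrefl : ∀ x → adj x x ≡ false

module _ (G : Graph) where
  open Graph G

  V : Set
  V = Fin n

  Adj : V → V → Set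
  Adj x y = T (adj x y)

  data Walk : V → V → ℕ → Set where
    nil  : ∀ {x} → Walk x x 0
    cons : ∀ {x y z ℓ} → Adj x y → Walk y z ℓ → Walk x z (suc ℓ)

  vertices : ∀ {x y ℓ} → Walk x y ℓ → List V
  vertices {x} nil = x ∷ []
  vertices {x} (cons _ w) = x ∷ vertices w

  IsPath : ∀ {x y ℓ} → Walk x y ℓ → Set
  IsPath w = Unique (vertices w)

  AvoidsInternal : (V → Set) → ∀ {x y ℓ} → Walk x y ℓ → Set
  AvoidsInternal P nil = ⊤
  AvoidsInternal P (cons _ nil) = ⊤
  AvoidsInternal P (cons _ (cons {x = y} a w)) =
    ¬ P y × AvoidsInternal P (cons a w)

  Dist : V → V → ℕ → Set
  Dist x y d = Walk x y d × (∀ ℓ → Walk x y ℓ → d ≤ ℓ)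

  Connected : Set
  Connected = ∀ x y → ∃[ ℓ ] Walk x y ℓ

  Acyclic : Set
  Acyclic = ¬ (Σ V λ x → Σ V λ y → Σ ℕ λ ℓ → Σ (Walk y x ℓ) λ w →
               IsPath w × 2 ≤ ℓ × Adj x y)

  IsTree : Set
  IsTree = 0 Data.Nat.< n × Connected × Acyclic

  deg : V → ℕ
  deg x = ∣ tabulate (adj x) ∣

  IsLeaf : V → Set
  IsLeaf x = deg x ≡ 1

  IsMaxDegree : ℕ → Set
  IsMaxDegree Δ = (∃[ x ] deg x ≡ Δ) × (∀ x → deg x ≤ Δ)

  IsDiam : ℕ → Set
  IsDiam D = (∃[ x ] ∃[ y ] Dist x y D) × (∀ x y d → Dist x y d → d ≤ D)

  IsComplete : Set
  IsComplete = IsTree × ∀ D → IsDiam D →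
    ∀ i → IsLeaf i → ∃[ j ] (IsLeaf j × Dist i j D)

  IsPerfect : Set
  IsPerfect = IsComplete ×
    (∀ x y → ¬ IsLeaf x → ¬ IsLeaf y → deg x ≡ deg y)

  Visible : Subset n → ℕ → V → V → Set
  Visible S k x y = ∃[ d ] (Dist x y d × d ≤ k ×
                     Σ (Walk x y d) λ w → AvoidsInternal (_∈ S) w)

  IsKDMV : ℕ → Subset n → Set
  IsKDMV k S = ∀ x y → x ∈ S → y ∈ S → Visible S k x y

  IsMuK : ℕ → ℕ → Set
  IsMuK k m = (∃[ S ] (IsKDMV k S × ∣ S ∣ ≡ m)) ×
              (∀ S → IsKDMV k S → ∣ S ∣ ≤ m)

-- In a tree, a k-distance mutual-visibility set S is a set of vertices at pairwise distance
-- at most k none of which lies on the geodesic between two others.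
--
-- Upper bound: root the tree at a vertex within ⌈k/2⌉ of every member of S (a minimiser of
-- the eccentricity with respect to S).  If a member is an ancestor of another member, all
-- of S lies below it, in one branch, and apart from it S is an antichain there; otherwise
-- S itself is an antichain.  Below a vertex whose descendants have at most Δ - 1 children,
-- an antichain reaching j levels deeper has at most (Δ - 1)^j elements.  For odd k at most
-- one branch of the root reaches depth (k + 1)/2, so all other branches contribute a factor
-- Δ - 1 less.
--
-- Lower bound: in a perfect tree every leaf is far from a centre c, so the vertices close
-- to c all have degree Δ.  The vertices whose distances to c and to c′ sum to k, with
-- c′ = c for even k and c′ a suitable neighbour of c for odd k, form a k-distance
-- mutual-visibility set, and counting them level by level gives exactly the bound.

module Submission where

open import Defs
open import Data.Nat using (ℕ; _≤_; _∸_; _*_; _^_; _/_; _%_)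
open import Data.Product using (_×_)
open import Relation.Binary.PropositionalEquality using (_≡_)

open import Data.Nat
  using (zero; suc; _+_; _<_; _≤?_; _<?_; _⊔_; z≤n; s≤s; z<s; s≤s⁻¹; NonZero)
  renaming (_≟_ to _≟ℕ_)
open import Data.Nat.Properties hiding (_≟_)
open import Data.Nat.DivMod using (m*n/n≡m; m*n%n≡0; [m+kn]%n≡m%n)
open import Data.Nat.Tactic.RingSolver using (solve-∀)
open import Algebra.Properties.Semiring.Sum +-*-semiring
  using (sum; sum-cong-≗; sum-replicate-zero; ∑-distrib-+; ∑-comm; *-distribˡ-sum; *-distribʳ-sum)
open import Algebra.Properties.CommutativeSemigroup *-commutativeSemigroup using (x∙yz≈y∙xz)
open import Data.Bool using (T; if_then_else_)
open import Data.Empty using (⊥)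
open import Data.Fin using (Fin; zero; suc; _≟_; fromℕ<)
import Data.Fin.Properties as Fin
open import Data.Fin.Subset using (Subset; inside; outside; ∣_∣) renaming (_∈_ to _∈ₛ_)
open import Data.Fin.Subset.Properties using () renaming (_∈?_ to _∈ₛ?_)
open import Data.List using (List; _∷_; allFin)
import Data.List.Extrema
open import Data.List.Membership.Propositional using (_∈_; _∉_)
open import Data.List.Membership.Propositional.Properties using (∈-allFin)
import Data.List.Membership.DecPropositional as DecMembership
open import Data.List.Relation.Binary.Subset.Propositional using (_⊆_)
open import Data.List.Relation.Unary.All as All using (All)
open import Data.List.Relation.Unary.AllPairs using ([]; _∷_)
open import Data.List.Relation.Unary.Any using (here; there)
open import Data.Product using (∃; _,_; proj₁; proj₂)
open import Data.Sum using (_⊎_; inj₁; inj₂)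
open import Data.Unit using (⊤; tt)
open import Data.Vec using ([]; _∷_; tabulate)
open import Data.Vec.Properties using (lookup∘tabulate; []=⇒lookup)
open import Function using (_∘_; id)
open import Relation.Binary using (tri<; tri≈; tri>)
open import Relation.Binary.PropositionalEquality
open import Relation.Nullary using (¬_; Dec; yes; no; does; contradiction)
open import Relation.Nullary.Decidable using (T?; _×-dec_; ¬?; decidable-stable)
open import Relation.Unary using (Pred; Decidable)
open import Level using (Level)

private
  variable
    ℓ₁ ℓ₂ : Level
    n : ℕ
    P : Set ℓ₁
    R : Set ℓ₂

𝟙 : Dec P → ℕ
𝟙 P? = if does P? then 1 else 0

𝟙≤1 : (P? : Dec P) → 𝟙 P? ≤ 1
𝟙≤1 (yes _) = s≤s z≤n
𝟙≤1 (no _)  = z≤n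

𝟙-yes : (P? : Dec P) → P → 𝟙 P? ≡ 1
𝟙-yes (yes _) _  = refl
𝟙-yes (no ¬p) p = contradiction p ¬p

𝟙-no : (P? : Dec P) → ¬ P → 𝟙 P? ≡ 0
𝟙-no (yes p) ¬p = contradiction p ¬p
𝟙-no (no _)  _  = refl

𝟙*𝟙-no : (P? : Dec P) (R? : Dec R) → (P → ¬ R) → 𝟙 P? * 𝟙 R? ≡ 0
𝟙*𝟙-no (yes p) R? ¬R = trans (+-identityʳ (𝟙 R?)) (𝟙-no R? (¬R p))
𝟙*𝟙-no (no _)  R? ¬R = refl

𝟙*-≤ : (P? : Dec P) {m n : ℕ} → (P → m ≤ n) → 𝟙 P? * m ≤ n
𝟙*-≤ (yes p) m≤n = ≤-trans (≤-reflexive (+-identityʳ _)) (m≤n p)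
𝟙*-≤ (no _)  _   = z≤n

𝟙*-positive : (P? : Dec P) {m : ℕ} → 0 < 𝟙 P? * m → P × 0 < m
𝟙*-positive (yes p) 0<m = p , subst (0 <_) (+-identityʳ _) 0<m

count : ∀ {P : Pred (Fin n) ℓ₁} → Decidable P → ℕ
count P? = sum (λ i → 𝟙 (P? i))

subset : ∀ {P : Pred (Fin n) ℓ₁} → Decidable P → Subset n
subset P? = tabulate (λ i → does (P? i))

∣subset∣≡count : ∀ {P : Pred (Fin n) ℓ₁} (P? : Decidable P) → ∣ subset P? ∣ ≡ count P?
∣subset∣≡count {zero}  P? = refl
∣subset∣≡count {suc n} P? with P? zero
... | yes _ = cong suc (∣subset∣≡count (λ i → P? (suc i)))
... | no _  = ∣subset∣≡count (λ i → P? (suc i))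

∈-subset⁻ : ∀ {P : Pred (Fin n) ℓ₁} (P? : Decidable P) {i} → i ∈ₛ subset P? → P i
∈-subset⁻ P? {i} i∈ with P? i | trans (sym (lookup∘tabulate (λ j → does (P? j)) i)) ([]=⇒lookup i∈)
... | yes Pi | _ = Pi

∣S∣≡count : (S : Subset n) → ∣ S ∣ ≡ count (_∈ₛ? S)
∣S∣≡count []            = refl
∣S∣≡count (inside ∷ S)  = cong suc (∣S∣≡count S)
∣S∣≡count (outside ∷ S) = ∣S∣≡count S

sum-mono-≤ : ∀ {f g : Fin n → ℕ} → (∀ i → f i ≤ g i) → sum f ≤ sum g
sum-mono-≤ {zero}  f≤g = z≤n
sum-mono-≤ {suc n} f≤g = +-mono-≤ (f≤g zero) (sum-mono-≤ (λ i → f≤g (suc i)))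

sum-zero : ∀ {f : Fin n → ℕ} → (∀ i → f i ≡ 0) → sum f ≡ 0
sum-zero {n} f≡0 = trans (sum-cong-≗ f≡0) (sum-replicate-zero n)

sum-≡-at : ∀ {f : Fin n → ℕ} j → (∀ i → i ≢ j → f i ≡ 0) → sum f ≡ f j
sum-≡-at {suc n} {f} zero    others =
  trans (cong (f zero +_) (sum-zero (λ i → others (suc i) λ ()))) (+-identityʳ (f zero))
sum-≡-at {suc n} {f} (suc j) others =
  cong₂ _+_ (others zero λ ()) (sum-≡-at j (λ i i≢j → others (suc i) (i≢j ∘ Fin.suc-injective)))

term≤sum : ∀ (f : Fin n → ℕ) j → f j ≤ sum f
term≤sum {suc n} f zero    = m≤m+n (f zero) _
term≤sum {suc n} f (suc j) = ≤-trans (term≤sum (λ i → f (suc i)) j) (m≤n+m _ (f zero))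

sum-positive : ∀ (f : Fin n → ℕ) → 0 < sum f → ∃ λ i → 0 < f i
sum-positive {suc n} f 0<Σ with f zero in eq
... | suc _ = zero , subst (0 <_) (sym eq) z<s
... | zero  with sum-positive (λ i → f (suc i)) 0<Σ
...   | i , 0<fi = suc i , 0<fi

sum≤-ofOnePositive : ∀ {f : Fin n → ℕ} {B} → (∀ i → f i ≤ B) →
                      (∀ i j → 0 < f i → 0 < f j → i ≡ j) → sum f ≤ B
sum≤-ofOnePositive {f = f} f≤B unique with 0 <? sum f
... | no  Σ≯0 = ≤-trans (≮⇒≥ Σ≯0) z≤n
... | yes 0<Σ with sum-positive f 0<Σ
...   | i , 0<fi = subst (_≤ _) (sym (sum-≡-at i vanishes)) (f≤B i)
  where
  vanishes : ∀ j → j ≢ i → f j ≡ 0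
  vanishes j j≢i = n≤0⇒n≡0 (≮⇒≥ (λ 0<fj → j≢i (unique j i 0<fj 0<fi)))

count-≟ : ∀ (j : Fin n) → count (_≟ j) ≡ 1
count-≟ j = trans (sum-≡-at j (λ i i≢j → 𝟙-no (i ≟ j) i≢j)) (𝟙-yes (j ≟ j) refl)

module _ {P : Pred (Fin n) ℓ₁} (P? : Decidable P) where

  sum-𝟙*-≤ : ∀ {f : Fin n → ℕ} {C} → (∀ i → P i → f i ≤ C) →
             sum (λ i → 𝟙 (P? i) * f i) ≤ count P? * C
  sum-𝟙*-≤ {f} {C} f≤C = begin
    sum (λ i → 𝟙 (P? i) * f i) ≤⟨ sum-mono-≤ termwise ⟩
    sum (λ i → 𝟙 (P? i) * C)   ≡⟨ *-distribʳ-sum C (λ i → 𝟙 (P? i)) ⟨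
    count P? * C               ∎
    where
    open ≤-Reasoning
    termwise : ∀ i → 𝟙 (P? i) * f i ≤ 𝟙 (P? i) * C
    termwise i with P? i
    ... | yes Pi = +-monoˡ-≤ 0 (f≤C i Pi)
    ... | no _   = z≤n

  sum-𝟙*-≡ : ∀ {f : Fin n → ℕ} {C} → (∀ i → P i → f i ≡ C) →
             sum (λ i → 𝟙 (P? i) * f i) ≡ count P? * C
  sum-𝟙*-≡ {f} {C} f≡C = trans (sum-cong-≗ termwise) (sym (*-distribʳ-sum C (λ i → 𝟙 (P? i))))
    where
    termwise : ∀ i → 𝟙 (P? i) * f i ≡ 𝟙 (P? i) * C
    termwise i with P? i
    ... | yes Pi = cong (_+ 0) (f≡C i Pi)
    ... | no _   = refl

module _ {n : ℕ} where
  open Data.List.Extrema ≤-totalOrder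

  opaque
    minimiser : (f : Fin n → ℕ) → Fin n → ∃ λ i → ∀ j → f i ≤ f j
    minimiser f i₀ =
      argmin f i₀ (allFin n) , λ j → All.lookup (f[argmin]≤f[xs] i₀ (allFin n)) (∈-allFin j)

    maximiser : (f : Fin n → ℕ) → Fin n → ∃ λ i → ∀ j → f j ≤ f i
    maximiser f i₀ =
      argmax f i₀ (allFin n) , λ j → All.lookup (f[xs]≤f[argmax] i₀ (allFin n)) (∈-allFin j)

module _ {P : Pred ℕ ℓ₁} (P? : Decidable P) where

  private
    search : ∀ fuel i → (∀ {j} → j < i → ¬ P j) → P (fuel + i) →
             ∃ λ m → P m × (∀ {j} → P j → m ≤ j)
    search fuel i below Pfuel+i with P? i
    ... | yes Pi = i , Pi , λ Pj → ≮⇒≥ (λ j<i → below j<i Pj)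
    search zero       i below Pi | no ¬Pi = contradiction Pi ¬Pi
    search (suc fuel) i below Pfuel+i | no ¬Pi =
      search fuel (suc i) below′ (subst P (sym (+-suc fuel i)) Pfuel+i)
      where
      below′ : ∀ {j} → j < suc i → ¬ P j
      below′ j<1+i with m<1+n⇒m<n∨m≡n j<1+i
      ... | inj₁ j<i  = below j<i
      ... | inj₂ refl = ¬Pi

  least : ∀ {m} → P m → ∃ λ k → P k × (∀ {j} → P j → k ≤ j)
  least {m} Pm = search m 0 (λ ()) (subst P (sym (+-identityʳ m)) Pm)

half-≤ : ∀ a b → a + a ≤ suc (b + b) → a ≤ b
half-≤ a b 2a≤2b+1 with a ≤? b
... | yes a≤b = a≤b
... | no  a≰b = contradiction (begin
  suc (suc (b + b))  ≡⟨ cong suc (+-suc b b) ⟨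
  suc b + suc b      ≤⟨ +-mono-≤ (≰⇒> a≰b) (≰⇒> a≰b) ⟩
  a + a              ≤⟨ 2a≤2b+1 ⟩
  suc (b + b)        ∎) 1+n≰n
  where open ≤-Reasoning

double-injective : ∀ {a b} → a + a ≡ b + b → a ≡ b
double-injective {a} {b} 2a≡2b = ≤-antisym
  (half-≤ a b (≤-trans (≤-reflexive 2a≡2b) (n≤1+n _)))
  (half-≤ b a (≤-trans (≤-reflexive (sym 2a≡2b)) (n≤1+n _)))

split-≤ : ∀ {a a′ b b′ k} → a + a′ ≡ k → b + b′ ≡ k → a + b ≤ k ⊎ a′ + b′ ≤ k
split-≤ {a} {a′} {b} {b′} {k} aa′≡k bb′≡k with a + b ≤? k
... | yes ab≤k = inj₁ ab≤k
... | no  ab≰k = inj₂ (<⇒≤ (+-cancelˡ-< k (a′ + b′) k (begin-strict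
  k + (a′ + b′)         <⟨ +-monoˡ-< (a′ + b′) (≰⇒> ab≰k) ⟩
  (a + b) + (a′ + b′)   ≡⟨ regroup a a′ b b′ ⟩
  (a + a′) + (b + b′)   ≡⟨ cong₂ _+_ aa′≡k bb′≡k ⟩
  k + k                 ∎)))
  where
  open ≤-Reasoning
  regroup : ∀ a a′ b b′ → (a + b) + (a′ + b′) ≡ (a + a′) + (b + b′)
  regroup = solve-∀

below-halves : ∀ {d d′ B B′ k} → d < B → d′ < B′ → B + B ≤ suc k → B′ + B′ ≤ suc k →
               d + d′ < k
below-halves {d} {d′} {B} {B′} {k} d<B d′<B′ 2B≤ 2B′≤ = half-≤ (suc (d + d′)) k (begin
  suc (d + d′) + suc (d + d′)   ≡⟨ regroup d d′ ⟩
  suc (d + d) + suc (d′ + d′)   ≤⟨ +-mono-≤ (odd d<B 2B≤) (odd d′<B′ 2B′≤) ⟩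
  k + k                         ≤⟨ n≤1+n (k + k) ⟩
  suc (k + k)                   ∎)
  where
  open ≤-Reasoning
  regroup : ∀ d d′ → suc (d + d′) + suc (d + d′) ≡ suc (d + d) + suc (d′ + d′)
  regroup = solve-∀
  odd : ∀ {e C} → e < C → C + C ≤ suc k → suc (e + e) ≤ k
  odd {e} e<C 2C≤ =
    s≤s⁻¹ (≤-trans (≤-reflexive (cong suc (sym (+-suc e e)))) (≤-trans (+-mono-≤ e<C e<C) 2C≤))

double-≤-suc : ∀ {a a′ k} → a + a′ ≡ k → a ≤ suc a′ → a + a ≤ suc k
double-≤-suc {a} {a′} aa′≡k a≤1+a′ =
  ≤-trans (+-monoʳ-≤ a a≤1+a′) (≤-reflexive (trans (+-suc a a′) (cong suc aa′≡k)))

⊔-double-≤ : ∀ {a b m} → a + a ≤ m → b + b ≤ m → (a ⊔ b) + (a ⊔ b) ≤ m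
⊔-double-≤ {a} {b} 2a≤m 2b≤m with ⊔-sel a b
... | inj₁ a⊔b≡a = subst (λ z → z + z ≤ _) (sym a⊔b≡a) 2a≤m
... | inj₂ a⊔b≡b = subst (λ z → z + z ≤ _) (sym a⊔b≡b) 2b≤m

≤-double-larger : ∀ {a b D} → D ≤ a + b → suc (b + b) ≤ D → D ≤ a + a
≤-double-larger {a} {b} D≤a+b 2b<D = ≤-trans D≤a+b (+-monoʳ-≤ a (≤-trans (n≤1+n b)
  (+-cancelʳ-≤ b (suc b) a (≤-trans 2b<D D≤a+b))))

even-or-odd : ∀ k → ∃ λ a → k ≡ a + a ⊎ k ≡ suc (a + a)
even-or-odd zero = 0 , inj₁ refl
even-or-odd (suc k) with even-or-odd k
... | a , inj₁ k≡2a  = a , inj₂ (cong suc k≡2a)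
... | a , inj₂ k≡2a+1 = suc a , inj₁ (trans (cong suc k≡2a+1) (cong suc (sym (+-suc a a))))

double≡*2 : ∀ a → a + a ≡ a * 2
double≡*2 a = trans (cong (a +_) (sym (+-identityʳ a))) (*-comm 2 a)

double%2 : ∀ a → (a + a) % 2 ≡ 0
double%2 a = trans (cong (_% 2) (double≡*2 a)) (m*n%n≡0 a 2)

suc-double%2 : ∀ a → suc (a + a) % 2 ≡ 1
suc-double%2 a = trans (cong (λ m → suc m % 2) (double≡*2 a)) ([m+kn]%n≡m%n 1 a 2)

double/2 : ∀ a → (a + a) / 2 ≡ a
double/2 a = trans (cong (_/ 2) (double≡*2 a)) (m*n/n≡m a 2)

module Walks (G : Graph) where

  private
    variable
      x y z q : V G
      a b ℓ : ℕ

  Adj-sym : Adj G x y → Adj G y x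
  Adj-sym {x} {y} = subst T (Graph.sym G x y)

  Adj-irrefl : ¬ Adj G x x
  Adj-irrefl {x} = subst T (Graph.irrefl G x)

  opaque
    Adj? : ∀ x y → Dec (Adj G x y)
    Adj? x y = T? (Graph.adj G x y)

  degree : V G → ℕ
  degree x = count (Adj? x)

  opaque
    unfolding Adj?

    deg≡degree : ∀ x → deg G x ≡ degree x
    deg≡degree x = ∣subset∣≡count (Adj? x)

  _∷ʳ_ : Walk G x y ℓ → Adj G y z → Walk G x z (suc ℓ)
  nil      ∷ʳ e = cons e nil
  cons f w ∷ʳ e = cons f (w ∷ʳ e)

  reverse : Walk G x y ℓ → Walk G y x ℓ
  reverse nil        = nil
  reverse (cons e w) = reverse w ∷ʳ Adj-sym e

  _++_ : Walk G x y a → Walk G y z b → Walk G x z (a + b)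
  nil      ++ w′ = w′
  cons e w ++ w′ = cons e (w ++ w′)

  source∈ : (w : Walk G x y ℓ) → x ∈ vertices G w
  source∈ nil        = here refl
  source∈ (cons _ _) = here refl

  ∈-∷ʳ⁻ : (w : Walk G x y ℓ) (e : Adj G y z) → q ∈ vertices G (w ∷ʳ e) →
          q ∈ vertices G w ⊎ q ≡ z
  ∈-∷ʳ⁻ nil        e (here q≡x)         = inj₁ (here q≡x)
  ∈-∷ʳ⁻ nil        e (there (here q≡z)) = inj₂ q≡z
  ∈-∷ʳ⁻ (cons f w) e (here q≡x)         = inj₁ (here q≡x)
  ∈-∷ʳ⁻ (cons f w) e (there q∈)         with ∈-∷ʳ⁻ w e q∈
  ... | inj₁ q∈w = inj₁ (there q∈w)
  ... | inj₂ q≡z = inj₂ q≡z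

  ∈-reverse⁻ : (w : Walk G x y ℓ) → q ∈ vertices G (reverse w) → q ∈ vertices G w
  ∈-reverse⁻ nil        q∈ = q∈
  ∈-reverse⁻ (cons e w) q∈ with ∈-∷ʳ⁻ (reverse w) (Adj-sym e) q∈
  ... | inj₁ q∈w  = there (∈-reverse⁻ w q∈w)
  ... | inj₂ refl = here refl

  ∈-++⁻ : (w : Walk G x y a) (w′ : Walk G y z b) → q ∈ vertices G (w ++ w′) →
          q ∈ vertices G w ⊎ q ∈ vertices G w′
  ∈-++⁻ nil        w′ q∈          = inj₂ q∈
  ∈-++⁻ (cons e w) w′ (here q≡x)  = inj₁ (here q≡x)
  ∈-++⁻ (cons e w) w′ (there q∈)  with ∈-++⁻ w w′ q∈
  ... | inj₁ q∈w  = inj₁ (there q∈w)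
  ... | inj₂ q∈w′ = inj₂ q∈w′

  walk-length0 : Walk G x y 0 → x ≡ y
  walk-length0 nil = refl

  walk? : ∀ ℓ x y → Dec (Walk G x y ℓ)
  walk? zero    x y with x ≟ y
  ... | yes refl = yes nil
  ... | no  x≢y  = no λ { nil → x≢y refl }
  walk? (suc ℓ) x y with Fin.any? (λ z → Adj? x z ×-dec walk? ℓ z y)
  ... | yes (_ , e , w) = yes (cons e w)
  ... | no  ¬step       = no λ { (cons e w) → ¬step (_ , e , w) }

module Distance (G : Graph) (connected : Connected G) where

  open Walks G public

  private
    variable
      a u v x y z q : V G
      ℓ : ℕ

  opaque
    shortestWalk : ∀ x y → ∃ λ d → Walk G x y d × (∀ {ℓ} → Walk G x y ℓ → d ≤ ℓ)
    shortestWalk x y = least (λ ℓ → walk? ℓ x y) (proj₂ (connected x y))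

  dist : V G → V G → ℕ
  dist x y = proj₁ (shortestWalk x y)

  geodesic : ∀ x y → Walk G x y (dist x y)
  geodesic x y = proj₁ (proj₂ (shortestWalk x y))

  dist-minimal : Walk G x y ℓ → dist x y ≤ ℓ
  dist-minimal {x} {y} = proj₂ (proj₂ (shortestWalk x y))

  Dist-dist : ∀ x y → Dist G x y (dist x y)
  Dist-dist x y = geodesic x y , λ _ → dist-minimal

  Dist⇒≡dist : ∀ {d} → Dist G x y d → d ≡ dist x y
  Dist⇒≡dist {x} {y} (w , minimal) = ≤-antisym (minimal _ (geodesic x y)) (dist-minimal w)

  dist-sym : ∀ x y → dist x y ≡ dist y x
  dist-sym x y = ≤-antisym (dist-minimal (reverse (geodesic y x))) (dist-minimal (reverse (geodesic x y)))

  dist-triangle : ∀ x y z → dist x z ≤ dist x y + dist y z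
  dist-triangle x y z = dist-minimal (geodesic x y ++ geodesic y z)

  dist-self : ∀ x → dist x x ≡ 0
  dist-self x = n≤0⇒n≡0 (dist-minimal {x} nil)

  dist≡0⇒≡ : dist x y ≡ 0 → x ≡ y
  dist≡0⇒≡ {x} {y} d≡0 = walk-length0 (subst (Walk G x y) d≡0 (geodesic x y))

  dist-adj : Adj G x y → dist x y ≤ 1
  dist-adj e = dist-minimal (cons e nil)

  ≢⇒0<dist : x ≢ y → 0 < dist x y
  ≢⇒0<dist {x} {y} x≢y with dist x y in d≡
  ... | zero  = contradiction (dist≡0⇒≡ d≡) x≢y
  ... | suc _ = s≤s z≤n

  adj⇒dist≡1 : Adj G x y → dist x y ≡ 1
  adj⇒dist≡1 e = ≤-antisym (dist-adj e) (≢⇒0<dist λ { refl → Adj-irrefl e })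

  dist-step≤ : ∀ z → Adj G u v → dist z v ≤ suc (dist z u)
  dist-step≤ {u} {v} z e = begin
    dist z v            ≤⟨ dist-triangle z u v ⟩
    dist z u + dist u v ≤⟨ +-monoʳ-≤ (dist z u) (dist-adj e) ⟩
    dist z u + 1        ≡⟨ +-comm (dist z u) 1 ⟩
    suc (dist z u)      ∎
    where open ≤-Reasoning

  geodesic-tail : (e : Adj G x u) (w : Walk G u y ℓ) → suc ℓ ≡ dist x y → ℓ ≡ dist u y
  geodesic-tail {x} {u} {y} e w 1+ℓ≡d = ≤-antisym
    (s≤s⁻¹ (≤-trans (≤-reflexive 1+ℓ≡d) (dist-minimal (cons e (geodesic u y)))))
    (dist-minimal w)

  geodesic-step : x ≢ y → ∃ λ u → Adj G x u × suc (dist u y) ≡ dist x y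
  geodesic-step {x} {y} x≢y = first (geodesic x y) refl
    where
    first : Walk G x y ℓ → ℓ ≡ dist x y → ∃ λ u → Adj G x u × suc (dist u y) ≡ dist x y
    first nil        _    = contradiction refl x≢y
    first (cons e w) ℓ≡d = _ , e , trans (cong suc (sym (geodesic-tail e w ℓ≡d))) ℓ≡d

  walk-dist-target : (w : Walk G x z ℓ) → q ∈ vertices G w → q ≡ x ⊎ suc (dist q z) ≤ ℓ
  walk-dist-target nil        (here q≡x) = inj₁ q≡x
  walk-dist-target (cons e w) (here q≡x) = inj₁ q≡x
  walk-dist-target (cons e w) (there q∈) with walk-dist-target w q∈
  ... | inj₁ refl = inj₂ (s≤s (dist-minimal w))
  ... | inj₂ lt   = inj₂ (m≤n⇒m≤1+n lt)

  walk-dist-target≤ : (w : Walk G x z ℓ) → q ∈ vertices G w → dist q z ≤ ℓ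
  walk-dist-target≤ w q∈ with walk-dist-target w q∈
  ... | inj₁ refl = dist-minimal w
  ... | inj₂ lt   = ≤-trans (n≤1+n _) lt

  Between : V G → V G → V G → Set
  Between a v b = dist a v + dist v b ≡ dist a b

  between-trans : Between x a y → Between a v y → Between x v y
  between-trans {x} {a} {y} {v} xay avy = ≤-antisym (begin
    dist x v + dist v y              ≤⟨ +-monoˡ-≤ (dist v y) (dist-triangle x a v) ⟩
    dist x a + dist a v + dist v y   ≡⟨ +-assoc (dist x a) (dist a v) (dist v y) ⟩
    dist x a + (dist a v + dist v y) ≡⟨ cong (dist x a +_) avy ⟩
    dist x a + dist a y              ≡⟨ xay ⟩
    dist x y                         ∎) (dist-triangle x v y)
    where open ≤-Reasoning

  NoMemberBetween : (V G → Set) → Set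
  NoMemberBetween Q = ∀ {a v b} → Q a → Q v → Q b → Between a v b → v ≢ a → v ≢ b → ⊥

  internal-avoided : ∀ {P : V G → Set} (w : Walk G x y ℓ) → AvoidsInternal G P w →
                     v ∈ vertices G w → v ≢ x → v ≢ y → ¬ P v
  internal-avoided nil                 _           (here v≡x)        v≢x _   = contradiction v≡x v≢x
  internal-avoided (cons e nil)        _           (here v≡x)        v≢x _   = contradiction v≡x v≢x
  internal-avoided (cons e nil)        _           (there (here v≡y)) _  v≢y = contradiction v≡y v≢y
  internal-avoided (cons e (cons f w)) _           (here v≡x)        v≢x _   = contradiction v≡x v≢x
  internal-avoided {v = v} (cons {y = u} e (cons f w)) (¬Pu , avoids) (there v∈) v≢x v≢y with v ≟ u
  ... | yes refl = ¬Pu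
  ... | no  v≢u  = internal-avoided (cons f w) avoids v∈ v≢u v≢y

  geodesic-avoids : ∀ {P : V G → Set} (w : Walk G x y ℓ) → ℓ ≡ dist x y →
                    (∀ v → v ∈ vertices G w → v ≢ x → v ≢ y → ¬ P v) → AvoidsInternal G P w
  geodesic-avoids nil          _   _       = tt
  geodesic-avoids (cons e nil) _   _       = tt
  geodesic-avoids {x} {y} {P = P} (cons {y = u} e (cons f w)) ℓ≡d avoid =
    avoid u (there (here refl)) u≢x u≢y ,
    geodesic-avoids (cons f w) (geodesic-tail e (cons f w) ℓ≡d) avoid′
    where
    u≢x : u ≢ x
    u≢x refl = Adj-irrefl e
    u≢y : u ≢ y
    u≢y refl = <⇒≱ (s≤s (s≤s z≤n)) (≤-trans (≤-reflexive ℓ≡d) (dist-adj e))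
    avoid′ : ∀ v → v ∈ vertices G (cons f w) → v ≢ u → v ≢ y → ¬ P v
    avoid′ v v∈ v≢u v≢y = avoid v (there v∈) v≢x v≢y
      where
      v≢x : v ≢ x
      v≢x refl = <⇒≱ (≤-reflexive ℓ≡d) (walk-dist-target≤ (cons f w) v∈)

  visible-via-geodesic : ∀ S k → dist x y ≤ k →
    (∀ v → v ∈ vertices G (geodesic x y) → v ≢ x → v ≢ y → ¬ v ∈ₛ S) → Visible G S k x y
  visible-via-geodesic {x} {y} S k d≤k avoid =
    dist x y , Dist-dist x y , d≤k , geodesic x y , geodesic-avoids (geodesic x y) refl avoid

module Tree (G : Graph) (tree : IsTree G) where

  open Distance G (proj₁ (proj₂ tree)) public
  open DecMembership (_≟_ {Graph.n G}) using (_∈?_)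

  private
    variable
      a b u v x y : V G
      ℓ : ℕ

  record PathWithin (x y : V G) (L : List (V G)) : Set where
    field
      {length} : ℕ
      path     : Walk G x y length
      isPath   : IsPath G path
      within   : vertices G path ⊆ L

  private
    suffix : (p : Walk G x y ℓ) → IsPath G p → u ∈ vertices G p → PathWithin u y (vertices G p)
    suffix nil        p-path       (here refl) = record { path = nil      ; isPath = p-path ; within = id }
    suffix (cons e p) p-path       (here refl) = record { path = cons e p ; isPath = p-path ; within = id }
    suffix (cons e p) (_ ∷ p-path) (there u∈)  = record
      { path = path ; isPath = isPath ; within = there ∘ within }
      where open PathWithin (suffix p p-path u∈)

    prepend : ∀ {L} → Adj G x a → PathWithin a y L → PathWithin x y (x ∷ L)
    prepend {x} e p with x ∈? vertices G (PathWithin.path p)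
    ... | yes x∈ = record { path = path ; isPath = isPath ; within = there ∘ PathWithin.within p ∘ within }
      where open PathWithin (suffix (PathWithin.path p) (PathWithin.isPath p) x∈)
    ... | no  x∉ = record
      { path   = cons e path
      ; isPath = All.tabulate (λ r∈ x≡r → x∉ (subst (_∈ _) (sym x≡r) r∈)) ∷ isPath
      ; within = λ { (here r≡x) → here r≡x ; (there r∈) → there (within r∈) } }
      where open PathWithin p

  shortcut : (w : Walk G x y ℓ) → PathWithin x y (vertices G w)
  shortcut nil        = record { path = nil ; isPath = All.[] ∷ [] ; within = id }
  shortcut (cons e w) = prepend e (shortcut w)

  no-cycle : (w : Walk G a x ℓ) → Adj G y a → Adj G x y → y ∉ vertices G w → a ≢ x → ⊥
  no-cycle {a} {x} {y = y} w ya xy y∉w a≢x with shortcut w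
  ... | record { length = zero ; path = p } = a≢x (walk-length0 p)
  ... | record { length = suc _ ; path = p ; isPath = p-path ; within = p⊆w } =
    proj₂ (proj₂ tree) (x , y , _ , cons ya p , y∉p ∷ p-path , s≤s (s≤s z≤n) , xy)
    where
    y∉p : All (y ≢_) (vertices G p)
    y∉p = All.tabulate λ r∈p y≡r → y∉w (p⊆w (subst (_∈ vertices G p) (sym y≡r) r∈p))

  not-farther-neighbour-unique : ∀ z {u v₁ v₂} → Adj G u v₁ → Adj G u v₂ →
    dist v₁ z ≤ dist u z → dist v₂ z ≤ dist u z → v₁ ≡ v₂
  not-farther-neighbour-unique z {u} {v₁} {v₂} e₁ e₂ v₁≤u v₂≤u with v₁ ≟ v₂
  ... | yes v₁≡v₂ = v₁≡v₂
  ... | no  v₁≢v₂ = contradiction v₁≢v₂ (no-cycle w e₁ (Adj-sym e₂) u∉w)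
    where
    w : Walk G v₁ v₂ (dist v₁ z + dist v₂ z)
    w = geodesic v₁ z ++ reverse (geodesic v₂ z)
    u∉ : ∀ {v} → Adj G u v → dist v z ≤ dist u z → u ∉ vertices G (geodesic v z)
    u∉ e v≤u u∈ with walk-dist-target (geodesic _ z) u∈
    ... | inj₁ refl = Adj-irrefl e
    ... | inj₂ u<v  = <⇒≱ u<v v≤u
    u∉w : u ∉ vertices G w
    u∉w u∈ with ∈-++⁻ (geodesic v₁ z) (reverse (geodesic v₂ z)) u∈
    ... | inj₁ u∈₁ = u∉ e₁ v₁≤u u∈₁
    ... | inj₂ u∈₂ = u∉ e₂ v₂≤u (∈-reverse⁻ (geodesic v₂ z) u∈₂)

  adjacent-not-equidistant : ∀ z → Adj G u v → dist z u ≢ dist z v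
  adjacent-not-equidistant {u} {v} z e du≡dv with u ≟ z
  ... | yes refl = Adj-irrefl (subst (Adj G u) (sym (dist≡0⇒≡ (trans (sym du≡dv) (dist-self u)))) e)
  ... | no  u≢z  with geodesic-step u≢z
  ...   | u′ , e′ , 1+u′≡u =
    1+n≢n (trans 1+u′≡u (trans (sym v≡u) (cong (λ w → dist w z) v≡u′)))
    where
    v≡u : dist v z ≡ dist u z
    v≡u = trans (dist-sym v z) (trans (sym du≡dv) (dist-sym z u))
    v≡u′ : v ≡ u′
    v≡u′ = not-farther-neighbour-unique z e e′
      (≤-reflexive v≡u) (≤-trans (n≤1+n _) (≤-reflexive 1+u′≡u))

  dist-step : ∀ z → Adj G u v → suc (dist z u) ≡ dist z v ⊎ suc (dist z v) ≡ dist z u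
  dist-step {u} {v} z e with <-cmp (dist z u) (dist z v)
  ... | tri< u<v _ _ = inj₁ (≤-antisym u<v (dist-step≤ z e))
  ... | tri≈ _ u≡v _ = contradiction u≡v (adjacent-not-equidistant z e)
  ... | tri> _ _ v<u = inj₂ (≤-antisym v<u (dist-step≤ z (Adj-sym e)))

  between⇒∈geodesic : (w : Walk G a b ℓ) → ℓ ≡ dist a b → Between a v b → v ∈ vertices G w
  between⇒∈geodesic {a} {v = v} w ℓ≡d btw with v ≟ a
  ... | yes refl = source∈ w
  between⇒∈geodesic {a} {v = v} nil ℓ≡d btw | no v≢a =
    contradiction (sym (dist≡0⇒≡ (m+n≡0⇒m≡0 _ (trans btw (dist-self a))))) v≢a
  between⇒∈geodesic {a} {b} {v = v} (cons {y = a′} {ℓ = ℓ′} e w) ℓ≡d btw | no v≢a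
    with geodesic-step (v≢a ∘ sym)
  ... | p , ap , 1+pv≡av =
    there (between⇒∈geodesic w ℓ′≡d′ (subst (λ q → Between q v b) p≡a′ btwₚ))
    where
    ℓ′≡d′ : ℓ′ ≡ dist a′ b
    ℓ′≡d′ = geodesic-tail e w ℓ≡d
    1+pvb≡ab : suc (dist p v + dist v b) ≡ dist a b
    1+pvb≡ab = trans (cong (_+ dist v b) 1+pv≡av) btw
    btwₚ : Between p v b
    btwₚ = ≤-antisym
      (s≤s⁻¹ (≤-trans (≤-reflexive 1+pvb≡ab) (dist-minimal (cons ap (geodesic p b)))))
      (dist-triangle p v b)
    p≡a′ : p ≡ a′
    p≡a′ = not-farther-neighbour-unique b ap e
      (≤-trans (≤-reflexive (sym btwₚ)) (≤-trans (n≤1+n _) (≤-reflexive 1+pvb≡ab)))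
      (≤-trans (≤-reflexive (sym ℓ′≡d′)) (≤-trans (n≤1+n _) (≤-reflexive ℓ≡d)))

module Rooted (G : Graph) (tree : IsTree G) (root : V G) where

  open Tree G tree

  private
    variable
      a b u v w x y q : V G
      ℓ B : ℕ

  depth : V G → ℕ
  depth = dist root

  -- u ≼ x: u lies on the geodesic from the root to x, i.e. u is an ancestor of x or x itself.
  _≼_ : V G → V G → Set
  u ≼ x = depth u + dist u x ≡ depth x

  _⋖_ : V G → V G → Set
  v ⋖ u = Adj G v u × suc (depth v) ≡ depth u

  opaque
    _≼?_ : ∀ u x → Dec (u ≼ x)
    u ≼? x = depth u + dist u x ≟ℕ depth x

    _⋖?_ : ∀ v u → Dec (v ⋖ u)
    v ⋖? u = Adj? v u ×-dec (suc (depth v) ≟ℕ depth u)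

  depth-root : depth root ≡ 0
  depth-root = dist-self root

  depth-step : Adj G u v → u ⋖ v ⊎ v ⋖ u
  depth-step e with dist-step root e
  ... | inj₁ u<v = inj₁ (e , u<v)
  ... | inj₂ v<u = inj₂ (Adj-sym e , v<u)

  parent-unique : u ⋖ x → v ⋖ x → u ≡ v
  parent-unique {x = x} (ux , u<x) (vx , v<x) =
    not-farther-neighbour-unique root (Adj-sym ux) (Adj-sym vx) (closer u<x) (closer v<x)
    where
    closer : ∀ {p} → suc (depth p) ≡ depth x → dist p root ≤ dist x root
    closer {p} p<x = subst₂ _≤_ (dist-sym root p) (dist-sym root x) (≤-trans (n≤1+n _) (≤-reflexive p<x))

  ≼-refl : x ≼ x
  ≼-refl {x} = trans (cong (depth x +_) (dist-self x)) (+-identityʳ (depth x))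

  root≼ : root ≼ x
  root≼ {x} = cong (_+ dist root x) depth-root

  ≼-trans : a ≼ b → b ≼ x → a ≼ x
  ≼-trans {a} {b} {x} a≼b b≼x = ≤-antisym (begin
    depth a + dist a x              ≤⟨ +-monoʳ-≤ (depth a) (dist-triangle a b x) ⟩
    depth a + (dist a b + dist b x) ≡⟨ +-assoc (depth a) _ _ ⟨
    depth a + dist a b + dist b x   ≡⟨ cong (_+ dist b x) a≼b ⟩
    depth b + dist b x              ≡⟨ b≼x ⟩
    depth x                         ∎) (dist-triangle root a x)
    where open ≤-Reasoning

  ≼⇒depth≤ : u ≼ x → depth u ≤ depth x
  ≼⇒depth≤ {u} {x} u≼x = ≤-trans (m≤m+n (depth u) (dist u x)) (≤-reflexive u≼x)

  ≼∧≢⇒depth< : u ≼ x → u ≢ x → depth u < depth x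
  ≼∧≢⇒depth< {u} {x} u≼x u≢x = begin-strict
    depth u              ≡⟨ +-identityʳ (depth u) ⟨
    depth u + 0          <⟨ +-monoʳ-< (depth u) (≢⇒0<dist u≢x) ⟩
    depth u + dist u x   ≡⟨ u≼x ⟩
    depth x              ∎
    where open ≤-Reasoning

  ⋖⇒≼ : v ⋖ u → v ≼ u
  ⋖⇒≼ {v} (e , v<u) = trans (cong (depth v +_) (adj⇒dist≡1 e)) (trans (+-comm (depth v) 1) v<u)

  ⋖-asym : u ⋖ v → ¬ v ⋖ u
  ⋖-asym (_ , 1+u≡v) (_ , 1+v≡u) =
    1+n≰n (≤-trans (≤-reflexive 1+u≡v) (≤-trans (n≤1+n _) (≤-reflexive 1+v≡u)))

  ⋖-nonroot : v ⋖ u → u ≢ root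
  ⋖-nonroot (_ , 1+v≡u) refl = 1+n≢0 (trans 1+v≡u depth-root)

  ⋖-depth : v ⋖ u → ∀ j → depth v + suc j ≡ depth u + j
  ⋖-depth {v} (_ , 1+v≡u) j = trans (+-suc (depth v) j) (cong (_+ j) 1+v≡u)

  child-toward : v ≼ x → v ≢ x → ∃ λ u → v ⋖ u × u ≼ x
  child-toward {v} {x} v≼x v≢x with geodesic-step v≢x
  ... | u , vu , 1+ux≡vx = u , (vu , 1+v≡u) , u≼x
    where
    via-u : depth v + suc (dist u x) ≡ depth x
    via-u = trans (cong (depth v +_) 1+ux≡vx) v≼x
    1+v≡u : suc (depth v) ≡ depth u
    1+v≡u = ≤-antisym
      (+-cancelʳ-≤ (dist u x) _ _
        (≤-trans (≤-reflexive (trans (sym (+-suc _ _)) via-u)) (dist-triangle root u x)))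
      (≤-trans (dist-step≤ root vu) ≤-refl)
    u≼x : u ≼ x
    u≼x = trans (cong (_+ dist u x) (sym 1+v≡u)) (trans (sym (+-suc _ _)) via-u)

  parent-exists : x ≢ root → ∃ λ p → p ⋖ x
  parent-exists {x} x≢root with geodesic-step x≢root
  ... | p , xp , 1+p≡x = p , Adj-sym xp , trans (cong suc (dist-sym root p)) (trans 1+p≡x (dist-sym x root))

  ≼-parent : w ≼ x → w ≢ x → v ⋖ x → w ≼ v
  ≼-parent {w} {x} w≼x w≢x v⋖x with geodesic-step (w≢x ∘ sym)
  ... | q , xq , 1+qw≡xw = subst (w ≼_) (parent-unique q⋖x v⋖x) w≼q
    where
    via-q : depth w + suc (dist w q) ≡ depth x
    via-q = trans (cong (λ d → depth w + suc d) (dist-sym w q))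
                  (trans (cong (depth w +_) (trans 1+qw≡xw (dist-sym x w))) w≼x)
    q<x : depth q < depth x
    q<x = ≤-trans (s≤s (dist-triangle root w q)) (≤-reflexive (trans (sym (+-suc _ _)) via-q))
    q⋖x : q ⋖ x
    q⋖x with depth-step xq
    ... | inj₁ (_ , 1+x≡q) = contradiction (≤-trans (≤-reflexive 1+x≡q) (<⇒≤ q<x)) 1+n≰n
    ... | inj₂ q⋖x         = q⋖x
    w≼q : w ≼ q
    w≼q = suc-injective (trans (sym (+-suc _ _)) (trans via-q (sym (proj₂ q⋖x))))

  ancestors-comparable : a ≼ x → b ≼ x → depth a ≤ depth b → a ≼ b
  ancestors-comparable {a} {x} {b} a≼x b≼x a≤b = go (dist b x) a≼x b≼x refl
    where
    go : ∀ k {x} → a ≼ x → b ≼ x → dist b x ≡ k → a ≼ b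
    go zero    a≼x b≼x d≡0 = subst (a ≼_) (sym (dist≡0⇒≡ d≡0)) a≼x
    go (suc k) {x} a≼x b≼x d≡1+k with parent-exists x≢root
      where
      b<x : depth b < depth x
      b<x = ≼∧≢⇒depth< b≼x λ { refl → 1+n≢0 (trans (sym d≡1+k) (dist-self b)) }
      x≢root : x ≢ root
      x≢root refl = n≮0 (≤-trans b<x (≤-reflexive depth-root))
    ... | p , p⋖x =
      go k (≼-parent a≼x a≢x p⋖x) (≼-parent b≼x b≢x p⋖x) (+-cancelˡ-≡ (depth b) _ _ bp≡)
      where
      b≢x : b ≢ x
      b≢x refl = 1+n≢0 (trans (sym d≡1+k) (dist-self b))
      a≢x : a ≢ x
      a≢x refl = <-irrefl refl (≤-<-trans a≤b (≼∧≢⇒depth< b≼x b≢x))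
      bp≡ : depth b + dist b p ≡ depth b + k
      bp≡ = suc-injective (begin
        suc (depth b + dist b p) ≡⟨ cong suc (≼-parent b≼x b≢x p⋖x) ⟩
        suc (depth p)            ≡⟨ proj₂ p⋖x ⟩
        depth x                  ≡⟨ b≼x ⟨
        depth b + dist b x       ≡⟨ cong (depth b +_) d≡1+k ⟩
        depth b + suc k          ≡⟨ +-suc (depth b) k ⟩
        suc (depth b + k)        ∎)
        where open ≡-Reasoning

  child-unique : v ⋖ u → v ⋖ w → u ≼ x → w ≼ x → u ≡ w
  child-unique {v} {u} {w} (_ , v<u) (_ , v<w) u≼x w≼x = dist≡0⇒≡ (+-cancelˡ-≡ (depth u) _ 0 (begin
    depth u + dist u w ≡⟨ ancestors-comparable u≼x w≼x (≤-reflexive u≡w) ⟩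
    depth w            ≡⟨ u≡w ⟨
    depth u            ≡⟨ +-identityʳ (depth u) ⟨
    depth u + 0        ∎))
    where
    open ≡-Reasoning
    u≡w : depth u ≡ depth w
    u≡w = trans (sym v<u) v<w

  geodesic-from-child : x ⋖ a → (w : Walk G a y ℓ) → suc ℓ ≡ dist x y → q ∈ vertices G w → q ≼ y
  geodesic-from-child x⋖a nil _ (here refl) = ≼-refl
  geodesic-from-child {x} {y = y} x⋖a (cons {y = b} e w) 1+ℓ≡d q∈ with depth-step e
  ... | inj₂ b⋖a = contradiction (dist-minimal (subst (λ z → Walk G z y _) (parent-unique b⋖a x⋖a) w))
                     (<⇒≱ (≤-trans (n≤1+n _) (≤-reflexive 1+ℓ≡d)))
  ... | inj₁ a⋖b = on-walk q∈
    where
    below-b : ∀ {r} → r ∈ vertices G w → r ≼ y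
    below-b = geodesic-from-child a⋖b w (geodesic-tail (proj₁ x⋖a) (cons e w) 1+ℓ≡d)
    on-walk : ∀ {r} → r ∈ vertices G (cons e w) → r ≼ y
    on-walk (here refl) = ≼-trans (⋖⇒≼ a⋖b) (below-b (source∈ w))
    on-walk (there r∈w) = below-b r∈w

  geodesic-internal-depth< : (w : Walk G x y ℓ) → ℓ ≡ dist x y → v ∈ vertices G w → v ≢ x → v ≢ y →
                             depth x ≤ B → depth y ≤ B → depth v < B
  geodesic-internal-depth< nil        _ (here v≡x) v≢x _ _ _ = contradiction v≡x v≢x
  geodesic-internal-depth< (cons e w) _ (here v≡x) v≢x _ _ _ = contradiction v≡x v≢x
  geodesic-internal-depth< {v = v} (cons {y = a} e w) ℓ≡d (there v∈) v≢x v≢y x≤B y≤B with depth-step e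
  ... | inj₁ x⋖a = ≤-trans (≼∧≢⇒depth< (geodesic-from-child x⋖a w ℓ≡d v∈) v≢y) y≤B
  ... | inj₂ a⋖x with v ≟ a
  ...   | yes refl = ≤-trans (≤-reflexive (proj₂ a⋖x)) x≤B
  ...   | no  v≢a  = geodesic-internal-depth< w (geodesic-tail e w ℓ≡d) v∈ v≢a v≢y
                       (≤-trans (n≤1+n _) (≤-trans (≤-reflexive (proj₂ a⋖x)) x≤B)) y≤B

  geodesic-top : (w : Walk G x y ℓ) → ℓ ≡ dist x y → ∃ λ m → Between x m y × m ≼ x × m ≼ y
  geodesic-top {x} nil _ = x , cong (_+ dist x x) (dist-self x) , ≼-refl , ≼-refl
  geodesic-top {x} {y} (cons {y = a} e w) ℓ≡d with depth-step e
  ... | inj₁ x⋖a = x , cong (_+ dist x y) (dist-self x) , ≼-refl ,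
                   ≼-trans (⋖⇒≼ x⋖a) (geodesic-from-child x⋖a w ℓ≡d (source∈ w))
  ... | inj₂ a⋖x with geodesic-top w (geodesic-tail e w ℓ≡d)
  ...   | m , amy , m≼a , m≼y = m , xmy , ≼-trans m≼a (⋖⇒≼ a⋖x) , m≼y
    where
    xmy : Between x m y
    xmy = ≤-antisym (begin
      dist x m + dist m y              ≤⟨ +-monoˡ-≤ (dist m y) (dist-triangle x a m) ⟩
      dist x a + dist a m + dist m y   ≤⟨ +-monoˡ-≤ (dist m y) (+-monoˡ-≤ (dist a m) (dist-adj e)) ⟩
      suc (dist a m + dist m y)        ≡⟨ cong suc amy ⟩
      suc (dist a y)                   ≡⟨ cong suc (geodesic-tail e w ℓ≡d) ⟨
      _                                ≡⟨ ℓ≡d ⟩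
      dist x y                         ∎) (dist-triangle x m y)
      where open ≤-Reasoning

  root-between-or-same-branch : ∀ x y → Between x root y ⊎ ∃ λ w → root ⋖ w × w ≼ x × w ≼ y
  root-between-or-same-branch x y with geodesic-top (geodesic x y) refl
  ... | m , xmy , m≼x , m≼y with m ≟ root
  ...   | yes refl  = inj₁ xmy
  ...   | no  m≢root with child-toward root≼ (m≢root ∘ sym)
  ...     | w , root⋖w , w≼m = inj₂ (w , root⋖w , ≼-trans w≼m m≼x , ≼-trans w≼m m≼y)

  depth-child-of-root : root ⋖ w → depth w ≡ 1
  depth-child-of-root (_ , 1+root≡w) = trans (sym 1+root≡w) (cong suc depth-root)

  dist-inside-root-child : root ⋖ w → w ≼ x → suc (dist w x) ≡ depth x
  dist-inside-root-child {w} {x} root⋖w w≼x =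
    trans (cong (_+ dist w x) (sym (depth-child-of-root root⋖w))) w≼x

  dist-outside-root-child : root ⋖ w → ¬ w ≼ x → dist w x ≡ suc (depth x)
  dist-outside-root-child {w} {x} root⋖w w⋠x with dist-step x (proj₁ root⋖w)
  ... | inj₁ x→root<x→w = trans (dist-sym w x) (sym (trans (cong suc (dist-sym root x)) x→root<x→w))
  ... | inj₂ x→w<x→root = contradiction w≼x w⋠x
    where
    w≼x : w ≼ x
    w≼x = trans (cong (_+ dist w x) (depth-child-of-root root⋖w))
                (trans (cong suc (dist-sym w x)) (trans x→w<x→root (dist-sym x root)))

  ≼-root : u ≼ root → u ≡ root
  ≼-root {u} u≼root = sym (dist≡0⇒≡ (m+n≡0⇒m≡0 (depth u) (trans u≼root depth-root)))

  ≼-nonroot : u ≢ root → u ≼ x → x ≢ root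
  ≼-nonroot u≢root u≼x refl = u≢root (≼-root u≼x)

  same-branch : root ⋖ u → root ⋖ w → u ≼ x → w ≼ y → ¬ Between x root y → u ≡ w
  same-branch {u} {w} {x} {y} root⋖u root⋖w u≼x w≼y ¬root-between with root-between-or-same-branch x y
  ... | inj₁ root-between           = contradiction root-between ¬root-between
  ... | inj₂ (v , root⋖v , v≼x , v≼y) =
    trans (child-unique root⋖u root⋖v u≼x v≼x) (child-unique root⋖v root⋖w v≼y w≼y)

  ≼⇒between : u ≼ v → v ≼ x → Between u v x
  ≼⇒between {u} {v} {x} u≼v v≼x = +-cancelˡ-≡ (depth u) _ _ (begin
    depth u + (dist u v + dist v x) ≡⟨ +-assoc (depth u) _ _ ⟨
    depth u + dist u v + dist v x   ≡⟨ cong (_+ dist v x) u≼v ⟩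
    depth v + dist v x              ≡⟨ v≼x ⟩
    depth x                         ≡⟨ ≼-trans u≼v v≼x ⟨
    depth u + dist u x              ∎)
    where open ≡-Reasoning

  Antichain : (V G → Set) → Set
  Antichain Q = ∀ {x y} → Q x → Q y → x ≼ y → x ≡ y

module Counting (G : Graph) (tree : IsTree G) (root : V G) where

  open Tree G tree
  open Rooted G tree root public

  private
    variable
      v : V G

  children : V G → ℕ
  children v = count (v ⋖?_)

  children-of-nonroot : v ≢ root → suc (children v) ≡ degree v
  children-of-nonroot {v} v≢root with parent-exists v≢root
  ... | p , p⋖v = begin
    suc (children v)                    ≡⟨ +-comm 1 (children v) ⟩
    children v + 1                      ≡⟨ cong (children v +_) (count-≟ p) ⟨
    children v + count (_≟ p)           ≡⟨ ∑-distrib-+ (λ u → 𝟙 (v ⋖? u)) (λ u → 𝟙 (u ≟ p)) ⟨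
    sum (λ u → 𝟙 (v ⋖? u) + 𝟙 (u ≟ p))  ≡⟨ sum-cong-≗ child-or-parent ⟩
    degree v                            ∎
    where
    open ≡-Reasoning
    child-or-parent : ∀ u → 𝟙 (v ⋖? u) + 𝟙 (u ≟ p) ≡ 𝟙 (Adj? v u)
    child-or-parent u with Adj? v u
    ... | no ¬vu = cong₂ _+_ (𝟙-no (v ⋖? u) (¬vu ∘ proj₁))
                             (𝟙-no (u ≟ p) λ { refl → ¬vu (Adj-sym (proj₁ p⋖v)) })
    ... | yes vu with depth-step vu
    ...   | inj₁ v⋖u = cong₂ _+_ (𝟙-yes (v ⋖? u) v⋖u) (𝟙-no (u ≟ p) λ { refl → ⋖-asym v⋖u p⋖v })
    ...   | inj₂ u⋖v = cong₂ _+_ (𝟙-no (v ⋖? u) (⋖-asym u⋖v)) (𝟙-yes (u ≟ p) (parent-unique u⋖v p⋖v))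

  children-of-root : children root ≡ degree root
  children-of-root = sum-cong-≗ child
    where
    child : ∀ u → 𝟙 (root ⋖? u) ≡ 𝟙 (Adj? root u)
    child u with Adj? root u
    ... | no ¬ru = 𝟙-no (root ⋖? u) (¬ru ∘ proj₁)
    ... | yes ru with depth-step ru
    ...   | inj₁ root⋖u = 𝟙-yes (root ⋖? u) root⋖u
    ...   | inj₂ u⋖root = contradiction refl (⋖-nonroot u⋖root)

  subtree-split : ∀ v x → 𝟙 (v ≼? x) ≡ 𝟙 (x ≟ v) + sum (λ u → 𝟙 (v ⋖? u) * 𝟙 (u ≼? x))
  subtree-split v x with v ≼? x | x ≟ v
  ... | yes _   | yes refl = cong suc (sym (sum-zero λ u →
    𝟙*𝟙-no (x ⋖? u) (u ≼? x) λ x⋖u u≼x → 1+n≰n (≤-trans (≤-reflexive (proj₂ x⋖u)) (≼⇒depth≤ u≼x))))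
  ... | yes v≼x | no  x≢v  with child-toward v≼x (x≢v ∘ sym)
  ...   | u₀ , v⋖u₀ , u₀≼x = sym (trans (sum-≡-at u₀ others) at-u₀)
    where
    others : ∀ u → u ≢ u₀ → 𝟙 (v ⋖? u) * 𝟙 (u ≼? x) ≡ 0
    others u u≢u₀ = 𝟙*𝟙-no (v ⋖? u) (u ≼? x) λ v⋖u u≼x → u≢u₀ (child-unique v⋖u v⋖u₀ u≼x u₀≼x)
    at-u₀ : 𝟙 (v ⋖? u₀) * 𝟙 (u₀ ≼? x) ≡ 1
    at-u₀ = cong₂ _*_ (𝟙-yes (v ⋖? u₀) v⋖u₀) (𝟙-yes (u₀ ≼? x) u₀≼x)
  subtree-split v x | no v⋠x | yes refl = contradiction ≼-refl v⋠x
  subtree-split v x | no v⋠x | no  _    = sym (sum-zero λ u →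
    𝟙*𝟙-no (v ⋖? u) (u ≼? x) λ v⋖u u≼x → v⋠x (≼-trans (⋖⇒≼ v⋖u) u≼x))

  module _ {Q : V G → Set} (Q? : Decidable Q) where

    subtreeCount : V G → ℕ
    subtreeCount v = sum (λ x → 𝟙 (Q? x) * 𝟙 (v ≼? x))

    subtreeCount-positive : 0 < subtreeCount v → ∃ λ x → Q x × v ≼ x
    subtreeCount-positive {v} 0<n with sum-positive (λ x → 𝟙 (Q? x) * 𝟙 (v ≼? x)) 0<n
    ... | x , 0<term with Q? x | v ≼? x
    ...   | yes Qx | yes v≼x = x , Qx , v≼x

    subtreeCount≤1 : (∀ x → Q x → v ≼ x → x ≡ v) → subtreeCount v ≤ 1
    subtreeCount≤1 {v} only-v = sum≤-ofOnePositive term≤1 unique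
      where
      term≤1 : ∀ x → 𝟙 (Q? x) * 𝟙 (v ≼? x) ≤ 1
      term≤1 x = *-mono-≤ (𝟙≤1 (Q? x)) (𝟙≤1 (v ≼? x))
      unique : ∀ x y → 0 < 𝟙 (Q? x) * 𝟙 (v ≼? x) → 0 < 𝟙 (Q? y) * 𝟙 (v ≼? y) → x ≡ y
      unique x y 0<x 0<y with Q? x | v ≼? x | Q? y | v ≼? y
      ... | yes Qx | yes v≼x | yes Qy | yes v≼y = trans (only-v x Qx v≼x) (sym (only-v y Qy v≼y))

    subtreeCount≡1 : Q v → (∀ x → Q x → v ≼ x → x ≡ v) → subtreeCount v ≡ 1
    subtreeCount≡1 {v} Qv only-v =
      trans (sum-≡-at v others) (cong₂ _*_ (𝟙-yes (Q? v) Qv) (𝟙-yes (v ≼? v) ≼-refl))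
      where
      others : ∀ x → x ≢ v → 𝟙 (Q? x) * 𝟙 (v ≼? x) ≡ 0
      others x x≢v = 𝟙*𝟙-no (Q? x) (v ≼? x) λ Qx v≼x → x≢v (only-v x Qx v≼x)

    subtreeCount-split : ∀ v → subtreeCount v ≡ 𝟙 (Q? v) + sum (λ u → 𝟙 (v ⋖? u) * subtreeCount u)
    subtreeCount-split v = begin
      sum (λ x → 𝟙 (Q? x) * 𝟙 (v ≼? x))
        ≡⟨ sum-cong-≗ (λ x → trans (cong (𝟙 (Q? x) *_) (subtree-split v x))
                                   (*-distribˡ-+ (𝟙 (Q? x)) _ _)) ⟩
      sum (λ x → 𝟙 (Q? x) * 𝟙 (x ≟ v) + 𝟙 (Q? x) * sum (λ u → 𝟙 (v ⋖? u) * 𝟙 (u ≼? x)))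
        ≡⟨ ∑-distrib-+ (λ x → 𝟙 (Q? x) * 𝟙 (x ≟ v)) _ ⟩
      sum (λ x → 𝟙 (Q? x) * 𝟙 (x ≟ v)) +
      sum (λ x → 𝟙 (Q? x) * sum (λ u → 𝟙 (v ⋖? u) * 𝟙 (u ≼? x)))
        ≡⟨ cong₂ _+_ self children-part ⟩
      𝟙 (Q? v) + sum (λ u → 𝟙 (v ⋖? u) * subtreeCount u) ∎
      where
      open ≡-Reasoning
      self : sum (λ x → 𝟙 (Q? x) * 𝟙 (x ≟ v)) ≡ 𝟙 (Q? v)
      self = trans
        (sum-≡-at v λ x x≢v → trans (cong (𝟙 (Q? x) *_) (𝟙-no (x ≟ v) x≢v)) (*-zeroʳ (𝟙 (Q? x))))
        (trans (cong (𝟙 (Q? v) *_) (𝟙-yes (v ≟ v) refl)) (*-identityʳ (𝟙 (Q? v))))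
      children-part : sum (λ x → 𝟙 (Q? x) * sum (λ u → 𝟙 (v ⋖? u) * 𝟙 (u ≼? x))) ≡
                      sum (λ u → 𝟙 (v ⋖? u) * subtreeCount u)
      children-part = begin
        sum (λ x → 𝟙 (Q? x) * sum (λ u → 𝟙 (v ⋖? u) * 𝟙 (u ≼? x)))
          ≡⟨ sum-cong-≗ (λ x → *-distribˡ-sum (𝟙 (Q? x)) (λ u → 𝟙 (v ⋖? u) * 𝟙 (u ≼? x))) ⟩
        sum (λ x → sum (λ u → 𝟙 (Q? x) * (𝟙 (v ⋖? u) * 𝟙 (u ≼? x))))
          ≡⟨ ∑-comm (λ x u → 𝟙 (Q? x) * (𝟙 (v ⋖? u) * 𝟙 (u ≼? x))) ⟩
        sum (λ u → sum (λ x → 𝟙 (Q? x) * (𝟙 (v ⋖? u) * 𝟙 (u ≼? x))))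
          ≡⟨ sum-cong-≗ (λ u → trans
               (sum-cong-≗ (λ x → x∙yz≈y∙xz (𝟙 (Q? x)) (𝟙 (v ⋖? u)) (𝟙 (u ≼? x))))
               (sym (*-distribˡ-sum (𝟙 (v ⋖? u)) (λ x → 𝟙 (Q? x) * 𝟙 (u ≼? x))))) ⟩
        sum (λ u → 𝟙 (v ⋖? u) * subtreeCount u) ∎

  module _ {Q : V G → Set} (Q? : Decidable Q) where

    count≡subtreeCount-root : count Q? ≡ subtreeCount Q? root
    count≡subtreeCount-root = sum-cong-≗ λ x →
      sym (trans (cong (𝟙 (Q? x) *_) (𝟙-yes (root ≼? x) root≼)) (*-identityʳ (𝟙 (Q? x))))

    subtreeCount-split∉ : ¬ Q v → subtreeCount Q? v ≡ sum (λ u → 𝟙 (v ⋖? u) * subtreeCount Q? u)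
    subtreeCount-split∉ {v} ¬Qv = trans (subtreeCount-split Q? v)
      (cong (_+ sum (λ u → 𝟙 (v ⋖? u) * subtreeCount Q? u)) (𝟙-no (Q? v) ¬Qv))

    count-split∉ : ¬ Q root → count Q? ≡ sum (λ u → 𝟙 (root ⋖? u) * subtreeCount Q? u)
    count-split∉ ¬Qroot = trans count≡subtreeCount-root (subtreeCount-split∉ ¬Qroot)

    subtreeCount-split∈ : Q v → subtreeCount Q? v ≡ suc (sum (λ u → 𝟙 (v ⋖? u) * subtreeCount Q? u))
    subtreeCount-split∈ {v} Qv = trans (subtreeCount-split Q? v)
      (cong (_+ sum (λ u → 𝟙 (v ⋖? u) * subtreeCount Q? u)) (𝟙-yes (Q? v) Qv))

  subtreeCount-cong : ∀ {Q R : V G → Set} (Q? : Decidable Q) (R? : Decidable R) v →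
                      (∀ x → v ≼ x → Q x → R x) → (∀ x → v ≼ x → R x → Q x) →
                      subtreeCount Q? v ≡ subtreeCount R? v
  subtreeCount-cong Q? R? v Q⇒R R⇒Q = sum-cong-≗ term
    where
    term : ∀ x → 𝟙 (Q? x) * 𝟙 (v ≼? x) ≡ 𝟙 (R? x) * 𝟙 (v ≼? x)
    term x with v ≼? x
    ... | no _    = trans (*-zeroʳ (𝟙 (Q? x))) (sym (*-zeroʳ (𝟙 (R? x))))
    ... | yes v≼x with Q? x | R? x
    ...   | yes _  | yes _  = refl
    ...   | no  _  | no  _  = refl
    ...   | yes Qx | no ¬Rx = contradiction (Q⇒R x v≼x Qx) ¬Rx
    ...   | no ¬Qx | yes Rx = contradiction (R⇒Q x v≼x Rx) ¬Qx

  AntichainBelow : (V G → Set) → V G → Set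
  AntichainBelow Q v = ∀ {x y} → Q x → Q y → v ≼ x → x ≼ y → x ≡ y

  module _ (b : ℕ) .{{_ : NonZero b}} (children≤b : ∀ v → v ≢ root → children v ≤ b)
           {Q : V G → Set} (Q? : Decidable Q) where

    subtreeCount≤^ : ∀ j v → v ≢ root → (∀ x → Q x → v ≼ x → depth x ≤ depth v + j) →
                     AntichainBelow Q v → subtreeCount Q? v ≤ b ^ j
    subtreeCount≤^ zero v _ shallow _ = subtreeCount≤1 Q? λ x Qx v≼x →
      sym (dist≡0⇒≡ (n≤0⇒n≡0 (+-cancelˡ-≤ (depth v) _ 0
        (≤-trans (≤-reflexive v≼x) (shallow x Qx v≼x)))))
    subtreeCount≤^ (suc j) v v≢root shallow antichain with Q? v
    ... | yes Qv = ≤-trans (subtreeCount≤1 Q? λ x Qx v≼x → sym (antichain Qv Qx ≼-refl v≼x))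
                           (m^n>0 b (suc j))
    ... | no ¬Qv = begin
      subtreeCount Q? v                            ≡⟨ subtreeCount-split∉ Q? ¬Qv ⟩
      sum (λ u → 𝟙 (v ⋖? u) * subtreeCount Q? u)  ≤⟨ sum-𝟙*-≤ (v ⋖?_) child-bound ⟩
      children v * b ^ j                           ≤⟨ *-monoˡ-≤ (b ^ j) (children≤b v v≢root) ⟩
      b * b ^ j                                    ∎
      where
      open ≤-Reasoning
      child-bound : ∀ u → v ⋖ u → subtreeCount Q? u ≤ b ^ j
      child-bound u v⋖u = subtreeCount≤^ j u (⋖-nonroot v⋖u)
        (λ x Qx u≼x → ≤-trans (shallow x Qx (≼-trans (⋖⇒≼ v⋖u) u≼x))
                              (≤-reflexive (⋖-depth v⋖u j)))
        (λ Qx Qy u≼x x≼y → antichain Qx Qy (≼-trans (⋖⇒≼ v⋖u) u≼x) x≼y)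

  opaque
    level? : ∀ m x → Dec (depth x ≡ m)
    level? m x = depth x ≟ℕ m

  module _ (b : ℕ) where

    subtreeCount-level : ∀ j v → (∀ x → v ≼ x → depth x < depth v + j → children x ≡ b) →
                         subtreeCount (level? (depth v + j)) v ≡ b ^ j
    subtreeCount-level zero v _ =
      subtreeCount≡1 (level? (depth v + 0)) (sym (+-identityʳ (depth v))) λ x x≡v+0 v≼x →
        sym (dist≡0⇒≡ (+-cancelˡ-≡ (depth v) _ 0 (trans v≼x x≡v+0)))
    subtreeCount-level (suc j) v full = begin
      subtreeCount (level? m) v
        ≡⟨ subtreeCount-split∉ (level? m) (m+1+n≰m (depth v) ∘ ≤-reflexive ∘ sym) ⟩
      sum (λ u → 𝟙 (v ⋖? u) * subtreeCount (level? m) u)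
        ≡⟨ sum-𝟙*-≡ (v ⋖?_) child-count ⟩
      children v * b ^ j
        ≡⟨ cong (_* b ^ j) (full v ≼-refl (m<m+n (depth v) z<s)) ⟩
      b * b ^ j                                           ∎
      where
      open ≡-Reasoning
      m : ℕ
      m = depth v + suc j
      child-count : ∀ u → v ⋖ u → subtreeCount (level? m) u ≡ b ^ j
      child-count u v⋖u = trans
        (cong (λ m → subtreeCount (level? m) u) (⋖-depth v⋖u j))
        (subtreeCount-level j u λ x u≼x x<u+j → full x (≼-trans (⋖⇒≼ v⋖u) u≼x)
          (≤-trans x<u+j (≤-reflexive (sym (⋖-depth v⋖u j)))))

    count-level : ∀ j → (∀ x → x ≢ root → depth x ≤ j → children x ≡ b) →
                  count (level? (suc j)) ≡ children root * b ^ j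
    count-level j full = begin
      count (level? (suc j))                                       ≡⟨ count-split∉ (level? (suc j)) root-shallow ⟩
      sum (λ u → 𝟙 (root ⋖? u) * subtreeCount (level? (suc j)) u)  ≡⟨ sum-𝟙*-≡ (root ⋖?_) child-count ⟩
      children root * b ^ j                                        ∎
      where
      open ≡-Reasoning
      root-shallow : depth root ≢ suc j
      root-shallow root≡1+j = 1+n≢0 (trans (sym root≡1+j) depth-root)
      child-count : ∀ u → root ⋖ u → subtreeCount (level? (suc j)) u ≡ b ^ j
      child-count u root⋖u = trans
        (cong (λ m → subtreeCount (level? (m + j)) u) (sym (depth-child-of-root root⋖u)))
        (subtreeCount-level j u λ x u≼x x<u+j → full x (≼-nonroot (⋖-nonroot root⋖u) u≼x)
          (s≤s⁻¹ (≤-trans x<u+j (≤-reflexive (cong (_+ j) (depth-child-of-root root⋖u))))))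

  module BoundedDegree (δ : ℕ) (degree≤ : ∀ v → degree v ≤ suc (suc δ))
                       {Q : V G → Set} (Q? : Decidable Q) where

    children≤ : ∀ v → v ≢ root → children v ≤ suc δ
    children≤ v v≢root = s≤s⁻¹ (≤-trans (≤-reflexive (children-of-nonroot v≢root)) (degree≤ v))

    children-root≤ : children root ≤ suc (suc δ)
    children-root≤ = ≤-trans (≤-reflexive children-of-root) (degree≤ root)

    subtreeCount-child≤ : ∀ h u → root ⋖ u → (∀ x → Q x → u ≼ x → depth x ≤ suc h) →
                          AntichainBelow Q u → subtreeCount Q? u ≤ suc δ ^ h
    subtreeCount-child≤ h u root⋖u shallow antichain =
      subtreeCount≤^ (suc δ) children≤ Q? h u (⋖-nonroot root⋖u)
        (λ x Qx u≼x → ≤-trans (shallow x Qx u≼x)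
                              (≤-reflexive (cong (_+ h) (sym (depth-child-of-root root⋖u)))))
        antichain

    count≤-root∈ : ∀ h → Q root → (∀ x → Q x → depth x ≤ suc h) → NoMemberBetween Q →
                   count Q? ≤ 1 + suc δ ^ h
    count≤-root∈ h Qroot shallow none-between = begin
      count Q?                                            ≡⟨ count≡subtreeCount-root Q? ⟩
      subtreeCount Q? root                                ≡⟨ subtreeCount-split∈ Q? Qroot ⟩
      1 + sum (λ u → 𝟙 (root ⋖? u) * subtreeCount Q? u)
        ≤⟨ +-monoʳ-≤ 1 (sum≤-ofOnePositive bounded one-branch) ⟩
      1 + suc δ ^ h                                       ∎
      where
      open ≤-Reasoning
      bounded : ∀ u → 𝟙 (root ⋖? u) * subtreeCount Q? u ≤ suc δ ^ h
      bounded u = 𝟙*-≤ (root ⋖? u) λ root⋖u →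
        subtreeCount-child≤ h u root⋖u (λ x Qx _ → shallow x Qx) λ {x} {y} Qx Qy u≼x x≼y →
          decidable-stable (x ≟ y) λ x≢y →
            none-between Qroot Qx Qy x≼y (≼-nonroot (⋖-nonroot root⋖u) u≼x) x≢y
      one-branch : ∀ u u′ → 0 < 𝟙 (root ⋖? u) * subtreeCount Q? u →
                   0 < 𝟙 (root ⋖? u′) * subtreeCount Q? u′ → u ≡ u′
      one-branch u u′ pos pos′ with 𝟙*-positive (root ⋖? u) pos | 𝟙*-positive (root ⋖? u′) pos′
      ... | root⋖u , 0<n | root⋖u′ , 0<n′ with subtreeCount-positive Q? 0<n | subtreeCount-positive Q? 0<n′
      ...   | x , Qx , u≼x | x′ , Qx′ , u′≼x′ = same-branch root⋖u root⋖u′ u≼x u′≼x′ λ root-between →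
        none-between Qx Qroot Qx′ root-between (≼-nonroot (⋖-nonroot root⋖u) u≼x ∘ sym)
                                               (≼-nonroot (⋖-nonroot root⋖u′) u′≼x′ ∘ sym)

    count≤-antichain : ∀ h → ¬ Q root → (∀ x → Q x → depth x ≤ suc h) → Antichain Q →
                       count Q? ≤ suc (suc δ) * suc δ ^ h
    count≤-antichain h ¬Qroot shallow antichain = begin
      count Q?                                        ≡⟨ count-split∉ Q? ¬Qroot ⟩
      sum (λ u → 𝟙 (root ⋖? u) * subtreeCount Q? u)  ≤⟨ sum-𝟙*-≤ (root ⋖?_) child-bound ⟩
      children root * suc δ ^ h                       ≤⟨ *-monoˡ-≤ (suc δ ^ h) children-root≤ ⟩
      suc (suc δ) * suc δ ^ h                         ∎
      where
      open ≤-Reasoning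
      child-bound : ∀ u → root ⋖ u → subtreeCount Q? u ≤ suc δ ^ h
      child-bound u root⋖u =
        subtreeCount-child≤ h u root⋖u (λ x Qx _ → shallow x Qx) λ Qx Qy _ → antichain Qx Qy

    module _ (h : ℕ) where

      Far : V G → Set
      Far u = root ⋖ u × ∃ λ x → Q x × u ≼ x × depth x ≡ suc (suc h)

      opaque
        far? : Decidable Far
        far? u = root ⋖? u ×-dec Fin.any? λ x → Q? x ×-dec u ≼? x ×-dec depth x ≟ℕ suc (suc h)

      count≤-antichain-oneFar : ¬ Q root → (∀ x → Q x → depth x ≤ suc (suc h)) → Antichain Q →
        (∀ {x y} → Q x → Q y → depth x ≡ suc (suc h) → depth y ≡ suc (suc h) → ¬ Between x root y) →
        count Q? ≤ 2 * (suc δ * suc δ ^ h)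
      count≤-antichain-oneFar ¬Qroot shallow antichain far-apart = begin
        count Q?                                               ≡⟨ count-split∉ Q? ¬Qroot ⟩
        sum (λ u → 𝟙 (root ⋖? u) * subtreeCount Q? u)         ≤⟨ sum-mono-≤ term-bound ⟩
        sum (λ u → 𝟙 (root ⋖? u) * X + 𝟙 (far? u) * (δ * X))
          ≡⟨ ∑-distrib-+ (λ u → 𝟙 (root ⋖? u) * X) _ ⟩
        sum (λ u → 𝟙 (root ⋖? u) * X) + sum (λ u → 𝟙 (far? u) * (δ * X))
          ≤⟨ +-mono-≤ (≤-trans (sum-𝟙*-≤ (root ⋖?_) λ _ _ → ≤-refl) (*-monoˡ-≤ X children-root≤))
                      (sum≤-ofOnePositive (λ u → 𝟙*-≤ (far? u) λ _ → ≤-refl) one-far) ⟩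
        suc (suc δ) * X + δ * X                                ≡⟨ regroup δ X ⟩
        2 * (suc δ * X)                                        ∎
        where
        open ≤-Reasoning
        X : ℕ
        X = suc δ ^ h
        regroup : ∀ δ X → suc (suc δ) * X + δ * X ≡ 2 * (suc δ * X)
        regroup = solve-∀
        -- A child reaching depth h + 2 contributes at most (δ + 1) * X = X + δ * X, any other
        -- child at most X; by `far-apart` at most one child reaches depth h + 2.
        child-bound : ∀ u → root ⋖ u → subtreeCount Q? u ≤ X + 𝟙 (far? u) * (δ * X)
        child-bound u root⋖u with far? u
        ... | yes _ = ≤-trans
          (subtreeCount-child≤ (suc h) u root⋖u (λ x Qx _ → shallow x Qx) λ Qx Qy _ → antichain Qx Qy)
          (≤-reflexive (cong (X +_) (sym (+-identityʳ (δ * X)))))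
        ... | no ¬far = ≤-trans
          (subtreeCount-child≤ h u root⋖u
            (λ x Qx u≼x → s≤s⁻¹ (≤∧≢⇒< (shallow x Qx) λ x-deep →
                                   ¬far (root⋖u , x , Qx , u≼x , x-deep)))
            λ Qx Qy _ → antichain Qx Qy)
          (m≤m+n X 0)
        term-bound : ∀ u → 𝟙 (root ⋖? u) * subtreeCount Q? u ≤ 𝟙 (root ⋖? u) * X + 𝟙 (far? u) * (δ * X)
        term-bound u with root ⋖? u
        ... | no _       = z≤n
        ... | yes root⋖u = ≤-trans (≤-reflexive (+-identityʳ _)) (≤-trans (child-bound u root⋖u)
                                    (+-monoˡ-≤ _ (≤-reflexive (sym (+-identityʳ X)))))
        one-far : ∀ u u′ → 0 < 𝟙 (far? u) * (δ * X) → 0 < 𝟙 (far? u′) * (δ * X) → u ≡ u′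
        one-far u u′ pos pos′ with 𝟙*-positive (far? u) pos | 𝟙*-positive (far? u′) pos′
        ... | (root⋖u , x , Qx , u≼x , x-deep) , _ | (root⋖u′ , x′ , Qx′ , u′≼x′ , x′-deep) , _ =
          same-branch root⋖u root⋖u′ u≼x u′≼x′ (far-apart Qx Qx′ x-deep x′-deep)

module Centre (G : Graph) (tree : IsTree G) where

  open Tree G tree

  private
    variable
      c x : V G

  module _ {Q : V G → Set} (Q? : Decidable Q) where

    reach : V G → V G → ℕ
    reach c x = 𝟙 (Q? x) * dist c x

    farthest : V G → V G
    farthest c = proj₁ (maximiser (reach c) (fromℕ< (proj₁ tree)))

    eccentricity : V G → ℕ
    eccentricity c = reach c (farthest c)

    dist≤eccentricity : Q x → dist c x ≤ eccentricity c
    dist≤eccentricity {x} {c} Qx = ≤-trans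
      (≤-reflexive (sym (trans (cong (_* dist c x) (𝟙-yes (Q? x) Qx)) (+-identityʳ (dist c x)))))
      (proj₂ (maximiser (reach c) (fromℕ< (proj₁ tree))) x)

    eccentricity≤ : ∀ {m} → (∀ x → Q x → dist c x ≤ m) → eccentricity c ≤ m
    eccentricity≤ {c} bound = 𝟙*-≤ (Q? (farthest c)) (bound (farthest c))

    eccentricity-attained : 0 < eccentricity c → Q (farthest c) × dist c (farthest c) ≡ eccentricity c
    eccentricity-attained {c} 0<e with 𝟙*-positive (Q? (farthest c)) 0<e
    ... | Qp , _ = Qp , sym (trans (cong (_* dist c (farthest c)) (𝟙-yes (Q? (farthest c)) Qp)) (+-identityʳ _))

    module _ (k : ℕ) (close : ∀ {x y} → Q x → Q y → dist x y ≤ k) where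

      eccentricity-descent : ∀ c → suc k < eccentricity c + eccentricity c →
                             ∃ λ w → eccentricity w < eccentricity c
      eccentricity-descent c large with eccentricity c in e≡ | eccentricity-attained {c}
      ... | zero  | _        = contradiction large (λ ())
      ... | suc e | attained with attained (s≤s z≤n)
      ...   | Qp , cp≡e with child-toward root≼ c≢p
        where
        open Rooted G tree c using (child-toward; root≼)
        c≢p : c ≢ farthest c
        c≢p c≡p = 1+n≢0 (trans (sym cp≡e) (trans (cong (dist c) (sym c≡p)) (dist-self c)))
      ...     | w , c⋖w , w≼p = w , s≤s (eccentricity≤ closer)
        where
        open Counting G tree c
        p : V G
        p = farthest c
        closer : ∀ y → Q y → dist w y ≤ e
        closer y Qy with w ≼? y
        ... | yes w≼y = s≤s⁻¹ (≤-trans (≤-reflexive (dist-inside-root-child c⋖w w≼y))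
                                        (≤-trans (dist≤eccentricity Qy) (≤-reflexive e≡)))
        ... | no  w⋠y with root-between-or-same-branch y p
        ...   | inj₂ (w′ , c⋖w′ , w′≼y , w′≼p) =
          contradiction (subst (_≼ y) (child-unique c⋖w′ c⋖w w′≼p w≼p) w′≼y) w⋠y
        ...   | inj₁ ycp =
          s≤s⁻¹ (≤-trans (≤-reflexive (cong suc (dist-outside-root-child c⋖w w⋠y))) two-shorter)
          where
          y+e≤k : depth y + suc e ≤ k
          y+e≤k = ≤-trans (≤-reflexive (trans (cong₂ _+_ (dist-sym c y) (sym cp≡e)) ycp)) (close Qy Qp)
          two-shorter : suc (suc (depth y)) ≤ suc e
          two-shorter = +-cancelʳ-≤ (suc e) _ _ (≤-trans (s≤s (s≤s y+e≤k)) large)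

      centre : ∃ λ c → ∀ x → Q x → dist c x + dist c x ≤ suc k
      centre with minimiser eccentricity (fromℕ< (proj₁ tree))
      ... | c , minimal with eccentricity c + eccentricity c ≤? suc k
      ...   | yes small =
        c , λ x Qx → ≤-trans (+-mono-≤ (dist≤eccentricity Qx) (dist≤eccentricity Qx)) small
      ...   | no  large with eccentricity-descent c (≰⇒> large)
      ...     | w , w<c = contradiction (minimal w) (<⇒≱ w<c)

module UpperBound (G : Graph) (tree : IsTree G) where

  open Tree G tree
  open Centre G tree

  private
    module At r = Rooted G tree r

  private
    variable
      x y : V G

  module _ {S : Subset (Graph.n G)} {k : ℕ} (S-visible : IsKDMV G k S) where

    members-close : x ∈ₛ S → y ∈ₛ S → dist x y ≤ k
    members-close {x} {y} x∈S y∈S with S-visible x y x∈S y∈S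
    ... | _ , d-dist , d≤k , _ = subst (_≤ k) (Dist⇒≡dist d-dist) d≤k

    no-member-between : NoMemberBetween (_∈ₛ S)
    no-member-between {a} {v} {b} a∈S v∈S b∈S avb v≢a v≢b with S-visible a b a∈S b∈S
    ... | _ , d-dist , _ , w , avoids =
      internal-avoided w avoids (between⇒∈geodesic w (Dist⇒≡dist d-dist) avb) v≢a v≢b v∈S

  count≤-by-cases : ∀ {Q : V G → Set} (Q? : Decidable Q) → NoMemberBetween Q → ∀ {H M} →
    (∀ r → Q r → (∀ x → Q x → dist r x ≤ H) → count Q? ≤ M) →
    (∀ r → ¬ Q r → At.Antichain r Q → (∀ x → Q x → dist r x ≤ H) → count Q? ≤ M) →
    ∀ c → (∀ x → Q x → dist c x ≤ H) → count Q? ≤ M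
  count≤-by-cases {Q} Q? none-between root∈ antichain c within with Q? c
  ... | yes Qc = root∈ c Qc within
  ... | no ¬Qc with Fin.any? (λ a → Fin.any? (λ b → Q? a ×-dec Q? b ×-dec a ≼? b ×-dec ¬? (a ≟ b)))
    where open Rooted G tree c using (_≼?_)
  ...   | no ¬pair = antichain c ¬Qc (λ {a} {b} Qa Qb a≼b → decidable-stable (a ≟ b) λ a≢b →
                                        ¬pair (a , b , Qa , Qb , a≼b , a≢b)) within
  ...   | yes (a , b , Qa , Qb , a≼b , a≢b) = root∈ a Qa λ s Qs →
    ≤-trans (m≤n+m (dist a s) (depth a)) (≤-trans (≤-reflexive (all-below s Qs)) (within s Qs))
    where
    open Rooted G tree c
    -- Otherwise a would lie between s and b.
    all-below : ∀ s → Q s → a ≼ s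
    all-below s Qs with s ≟ a
    ... | yes refl = ≼-refl
    ... | no  s≢a with geodesic-top (geodesic s b) refl
    ...   | m , smb , m≼s , m≼b with ≤-total (depth a) (depth m)
    ...     | inj₁ a≤m = ≼-trans (ancestors-comparable a≼b m≼b a≤m) m≼s
    ...     | inj₂ m≤a = contradiction (between-trans smb (≼⇒between (ancestors-comparable m≼b a≼b m≤a) a≼b))
                                       λ sab → none-between Qs Qa Qb sab (s≢a ∘ sym) a≢b

  module _ (δ : ℕ) (degree≤ : ∀ v → degree v ≤ suc (suc δ)) {S : Subset (Graph.n G)} where

    private
      module Bounds r = Counting.BoundedDegree G tree r δ degree≤ (_∈ₛ? S)

    upper-even : ∀ h → IsKDMV G (suc h + suc h) S → ∣ S ∣ ≤ suc (suc δ) * suc δ ^ h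
    upper-even h S-visible = begin
      ∣ S ∣           ≡⟨ ∣S∣≡count S ⟩
      count (_∈ₛ? S)  ≤⟨ count≤-by-cases (_∈ₛ? S) (no-member-between S-visible) root∈ antichain c within ⟩
      suc (suc δ) * X ∎
      where
      open ≤-Reasoning
      X : ℕ
      X = suc δ ^ h
      central : ∃ λ c → ∀ x → x ∈ₛ S → dist c x + dist c x ≤ suc (suc h + suc h)
      central = centre (_∈ₛ? S) (suc h + suc h) (members-close S-visible)
      c : V G
      c = proj₁ central
      within : ∀ x → x ∈ₛ S → dist c x ≤ suc h
      within x x∈S = half-≤ (dist c x) (suc h) (proj₂ central x x∈S)
      root∈ : ∀ r → r ∈ₛ S → (∀ x → x ∈ₛ S → dist r x ≤ suc h) → count (_∈ₛ? S) ≤ suc (suc δ) * X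
      root∈ r r∈S within-r = ≤-trans (Bounds.count≤-root∈ r h r∈S within-r (no-member-between S-visible))
                                     (+-mono-≤ (m^n>0 (suc δ) h) (m≤m+n X (δ * X)))
      antichain : ∀ r → ¬ r ∈ₛ S → At.Antichain r (_∈ₛ S) → (∀ x → x ∈ₛ S → dist r x ≤ suc h) →
                  count (_∈ₛ? S) ≤ suc (suc δ) * X
      antichain r r∉S anti within-r = Bounds.count≤-antichain r h r∉S within-r anti

    upper-odd : ∀ h → IsKDMV G (suc (suc h + suc h)) S → ∣ S ∣ ≤ 2 * suc δ ^ suc h
    upper-odd h S-visible = begin
      ∣ S ∣                ≡⟨ ∣S∣≡count S ⟩
      count (_∈ₛ? S)       ≤⟨ count≤-by-cases (_∈ₛ? S) (no-member-between S-visible) root∈ antichain c within ⟩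
      2 * suc δ ^ suc h    ∎
      where
      open ≤-Reasoning
      k X : ℕ
      k = suc (suc h + suc h)
      X = suc δ ^ suc h
      central : ∃ λ c → ∀ x → x ∈ₛ S → dist c x + dist c x ≤ suc k
      central = centre (_∈ₛ? S) k (members-close S-visible)
      c : V G
      c = proj₁ central
      within : ∀ x → x ∈ₛ S → dist c x ≤ suc (suc h)
      within x x∈S = half-≤ (dist c x) (suc (suc h))
        (≤-trans (proj₂ central x x∈S)
                 (s≤s (≤-trans (n≤1+n _) (≤-reflexive (cong suc (sym (+-suc (suc h) (suc h))))))))
      root∈ : ∀ r → r ∈ₛ S → (∀ x → x ∈ₛ S → dist r x ≤ suc (suc h)) → count (_∈ₛ? S) ≤ 2 * X
      root∈ r r∈S within-r = ≤-trans (Bounds.count≤-root∈ r (suc h) r∈S within-r (no-member-between S-visible))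
                                     (+-mono-≤ (m^n>0 (suc δ) (suc h)) (m≤m+n X 0))
      antichain : ∀ r → ¬ r ∈ₛ S → At.Antichain r (_∈ₛ S) → (∀ x → x ∈ₛ S → dist r x ≤ suc (suc h)) →
                  count (_∈ₛ? S) ≤ 2 * X
      antichain r r∉S anti within-r = Bounds.count≤-antichain-oneFar r h r∉S within-r anti far-apart
        where
        far-apart : ∀ {x y} → x ∈ₛ S → y ∈ₛ S → dist r x ≡ suc (suc h) → dist r y ≡ suc (suc h) →
                    ¬ Between x r y
        far-apart {x} {y} x∈S y∈S rx≡ ry≡ xry = 1+n≰n (begin
          suc k                          ≡⟨ cong suc (sym (+-suc (suc h) (suc h))) ⟩
          suc (suc h) + suc (suc h)      ≡⟨ cong₂ _+_ (trans (sym rx≡) (dist-sym r x)) (sym ry≡) ⟩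
          dist x r + dist r y            ≡⟨ xry ⟩
          dist x y                       ≤⟨ members-close S-visible x∈S y∈S ⟩
          k                              ∎)

module LowerBound (G : Graph) (tree : IsTree G) where

  open Tree G tree

  private
    module At r = Counting G tree r

  distanceSum-visible : ∀ {c c′} k → dist c c′ ≤ 1 → (S : Subset (Graph.n G)) →
                        (∀ {x} → x ∈ₛ S → dist c x + dist c′ x ≡ k) → IsKDMV G k S
  distanceSum-visible {c} {c′} k cc′≤1 S on-level x y x∈S y∈S =
    visible-via-geodesic S k xy≤k λ v v∈ v≢x v≢y v∈S → <-irrefl (on-level v∈S) (inner-closer v∈ v≢x v≢y)
    where
    near : ∀ a b {z} → dist a b ≤ 1 → dist a z + dist b z ≡ k → dist a z + dist a z ≤ suc k
    near a b {z} ab≤1 sum≡k =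
      double-≤-suc sum≡k (≤-trans (dist-triangle a b z) (+-monoˡ-≤ (dist b z) ab≤1))
    near-c : ∀ {z} → z ∈ₛ S → dist c z + dist c z ≤ suc k
    near-c z∈S = near c c′ cc′≤1 (on-level z∈S)
    near-c′ : ∀ {z} → z ∈ₛ S → dist c′ z + dist c′ z ≤ suc k
    near-c′ {z} z∈S = near c′ c (≤-trans (≤-reflexive (dist-sym c′ c)) cc′≤1)
                                (trans (+-comm (dist c′ z) (dist c z)) (on-level z∈S))
    -- Members are within ⌈k/2⌉ of c and of c′; inner vertices of a geodesic between two
    -- members are strictly closer to both.
    inner-closer : ∀ {v} → v ∈ vertices G (geodesic x y) → v ≢ x → v ≢ y → dist c v + dist c′ v < k
    inner-closer v∈ v≢x v≢y = below-halves
      (At.geodesic-internal-depth< c  (geodesic x y) refl v∈ v≢x v≢y (m≤m⊔n _ _) (m≤n⊔m _ _))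
      (At.geodesic-internal-depth< c′ (geodesic x y) refl v∈ v≢x v≢y (m≤m⊔n _ _) (m≤n⊔m _ _))
      (⊔-double-≤ {dist c x} {dist c y} (near-c x∈S) (near-c y∈S))
      (⊔-double-≤ {dist c′ x} {dist c′ y} (near-c′ x∈S) (near-c′ y∈S))
    via : ∀ m → dist m x + dist m y ≤ k → dist x y ≤ k
    via m mx+my≤k = ≤-trans (dist-triangle x m y)
                            (≤-trans (≤-reflexive (cong (_+ dist m y) (dist-sym x m))) mx+my≤k)
    xy≤k : dist x y ≤ k
    xy≤k with split-≤ {dist c x} {dist c′ x} {dist c y} {dist c′ y} (on-level x∈S) (on-level y∈S)
    ... | inj₁ via-c  = via c via-c
    ... | inj₂ via-c′ = via c′ via-c′

  opaque
    distanceSum? : ∀ c c′ k x → Dec (dist c x + dist c′ x ≡ k)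
    distanceSum? c c′ k x = dist c x + dist c′ x ≟ℕ k

  adjacent-≼ : ∀ {c c′ x} → Adj G c c′ → suc (dist c′ x) ≡ dist c x → At._≼_ c c′ x
  adjacent-≼ {c} {c′} {x} e 1+c′x≡cx = trans (cong (_+ dist c′ x) (adj⇒dist≡1 e)) 1+c′x≡cx

  adjacent-⋠ : ∀ {c c′ x} → Adj G c c′ → suc (dist c′ x) ≡ dist c x → ¬ At._≼_ c′ c x
  adjacent-⋠ {c} {c′} {x} e 1+c′x≡cx c≼x = 1+n≰n (≤-trans (n≤1+n _) (≤-reflexive (begin
    suc (suc (dist c′ x))   ≡⟨ cong suc 1+c′x≡cx ⟩
    suc (dist c x)          ≡⟨ cong (_+ dist c x) (adj⇒dist≡1 (Adj-sym e)) ⟨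
    dist c′ c + dist c x    ≡⟨ c≼x ⟩
    dist c′ x               ∎)))
    where open ≡-Reasoning

  edge-partition : ∀ {c c′} → Adj G c c′ → ∀ x →
                   𝟙 (At._≼?_ c c′ x) + 𝟙 (At._≼?_ c′ c x) ≡ 1
  edge-partition {c} {c′} e x with dist-step x e
  ... | inj₁ 1+xc≡xc′ = cong₂ _+_ (𝟙-no (At._≼?_ c c′ x) (adjacent-⋠ (Adj-sym e) c-side))
                                  (𝟙-yes (At._≼?_ c′ c x) (adjacent-≼ (Adj-sym e) c-side))
    where
    c-side : suc (dist c x) ≡ dist c′ x
    c-side = trans (cong suc (dist-sym c x)) (trans 1+xc≡xc′ (dist-sym x c′))
  ... | inj₂ 1+xc′≡xc = cong₂ _+_ (𝟙-yes (At._≼?_ c c′ x) (adjacent-≼ e c′-side))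
                                  (𝟙-no (At._≼?_ c′ c x) (adjacent-⋠ e c′-side))
    where
    c′-side : suc (dist c′ x) ≡ dist c x
    c′-side = trans (cong suc (dist-sym c′ x)) (trans 1+xc′≡xc (dist-sym x c))

  count-edge-split : ∀ {c c′} → Adj G c c′ → ∀ {Q : V G → Set} (Q? : Decidable Q) →
                     count Q? ≡ At.subtreeCount c Q? c′ + At.subtreeCount c′ Q? c
  count-edge-split {c} {c′} e Q? = begin
    sum (λ x → 𝟙 (Q? x))
      ≡⟨ sum-cong-≗ split ⟩
    sum (λ x → 𝟙 (Q? x) * 𝟙 (At._≼?_ c c′ x) + 𝟙 (Q? x) * 𝟙 (At._≼?_ c′ c x))
      ≡⟨ ∑-distrib-+ (λ x → 𝟙 (Q? x) * 𝟙 (At._≼?_ c c′ x)) _ ⟩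
    At.subtreeCount c Q? c′ + At.subtreeCount c′ Q? c ∎
    where
    open ≡-Reasoning
    split : ∀ x → 𝟙 (Q? x) ≡ 𝟙 (Q? x) * 𝟙 (At._≼?_ c c′ x) + 𝟙 (Q? x) * 𝟙 (At._≼?_ c′ c x)
    split x = trans (sym (*-identityʳ (𝟙 (Q? x))))
                    (trans (cong (𝟙 (Q? x) *_) (sym (edge-partition e x))) (*-distribˡ-+ (𝟙 (Q? x)) _ _))

  module _ (δ : ℕ) (internal-degree : ∀ x → ¬ IsLeaf G x → degree x ≡ suc (suc δ)) where

    children-internal : ∀ r {x} → x ≢ r → ¬ IsLeaf G x → At.children r x ≡ suc δ
    children-internal r x≢r x-internal =
      suc-injective (trans (At.children-of-nonroot r x≢r) (internal-degree _ x-internal))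

    level-set-count : ∀ c h → (∀ ℓ → IsLeaf G ℓ → suc h + suc h ≤ dist c ℓ + dist c ℓ) →
                      count (At.level? c (suc h)) ≡ suc (suc δ) * suc δ ^ h
    level-set-count c h leaves-deep = trans (count-level (suc δ) h full) (cong (_* suc δ ^ h) root-children)
      where
      open Counting G tree c
      shallow-internal : ∀ {x} → depth x ≤ h → ¬ IsLeaf G x
      shallow-internal {x} x≤h leaf = <⇒≱ (+-mono-< (s≤s x≤h) (s≤s x≤h)) (leaves-deep x leaf)
      full : ∀ x → x ≢ c → depth x ≤ h → children x ≡ suc δ
      full x x≢c x≤h = children-internal c x≢c (shallow-internal x≤h)
      root-children : children c ≡ suc (suc δ)
      root-children = trans children-of-root
        (internal-degree c (shallow-internal (≤-trans (≤-reflexive depth-root) z≤n)))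

    side-count : ∀ {c c′} t → Adj G c c′ → (∀ ℓ → IsLeaf G ℓ → suc (t + t) ≤ dist c ℓ + dist c′ ℓ) →
                 At.subtreeCount c (distanceSum? c c′ (suc (t + t))) c′ ≡ suc δ ^ t
    side-count {c} {c′} t e leaves-far = begin
      subtreeCount (distanceSum? c c′ (suc (t + t))) c′
        ≡⟨ subtreeCount-cong (distanceSum? c c′ (suc (t + t))) (level? (suc t)) c′ to-level from-level ⟩
      subtreeCount (level? (suc t)) c′
        ≡⟨ cong (λ m → subtreeCount (level? (m + t)) c′) (sym c′-depth) ⟩
      subtreeCount (level? (depth c′ + t)) c′
        ≡⟨ subtreeCount-level (suc δ) t c′ full ⟩
      suc δ ^ t                                           ∎
      where
      open ≡-Reasoning
      open Counting G tree c
      c′-depth : depth c′ ≡ 1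
      c′-depth = adj⇒dist≡1 e
      one-further : ∀ {x} → c′ ≼ x → dist c x ≡ suc (dist c′ x)
      one-further {x} c′≼x = trans (sym c′≼x) (cong (_+ dist c′ x) c′-depth)
      distance-sum : ∀ {x} → c′ ≼ x → dist c x + dist c′ x ≡ suc (dist c′ x + dist c′ x)
      distance-sum c′≼x = cong (_+ _) (one-further c′≼x)
      to-level : ∀ x → c′ ≼ x → dist c x + dist c′ x ≡ suc (t + t) → depth x ≡ suc t
      to-level x c′≼x sum≡ = trans (one-further c′≼x)
        (cong suc (double-injective (suc-injective (trans (sym (distance-sum c′≼x)) sum≡))))
      from-level : ∀ x → c′ ≼ x → depth x ≡ suc t → dist c x + dist c′ x ≡ suc (t + t)
      from-level x c′≼x x≡1+t = trans (distance-sum c′≼x) (cong (λ d → suc (d + d)) c′x≡t)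
        where
        c′x≡t : dist c′ x ≡ t
        c′x≡t = suc-injective (trans (sym (one-further c′≼x)) x≡1+t)
      full : ∀ x → c′ ≼ x → depth x < depth c′ + t → children x ≡ suc δ
      full x c′≼x x<1+t = children-internal c x≢c λ leaf → <⇒≱ sum< (leaves-far x leaf)
        where
        x≢c : x ≢ c
        x≢c refl = Adj-irrefl (subst (Adj G c) (≼-root c′≼x) e)
        c′x<t : dist c′ x < t
        c′x<t = s≤s⁻¹ (≤-trans (≤-reflexive (cong suc (sym (one-further c′≼x))))
                              (≤-trans x<1+t (≤-reflexive (cong (_+ t) c′-depth))))
        sum< : dist c x + dist c′ x < suc (t + t)
        sum< = ≤-trans (≤-reflexive (cong suc (distance-sum c′≼x))) (s≤s (+-mono-< c′x<t c′x<t))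

    even-witness : ∀ c h → (∀ ℓ → IsLeaf G ℓ → suc h + suc h ≤ dist c ℓ + dist c ℓ) →
                   ∃ λ S → IsKDMV G (suc h + suc h) S × ∣ S ∣ ≡ suc (suc δ) * suc δ ^ h
    even-witness c h leaves-deep =
      subset level ,
      distanceSum-visible (suc h + suc h) (≤-trans (≤-reflexive (dist-self c)) z≤n) (subset level) on-level ,
      trans (∣subset∣≡count level) (level-set-count c h leaves-deep)
      where
      level : Decidable (λ x → At.depth c x ≡ suc h)
      level = At.level? c (suc h)
      on-level : ∀ {x} → x ∈ₛ subset level → dist c x + dist c x ≡ suc h + suc h
      on-level x∈ = cong₂ _+_ (∈-subset⁻ level x∈) (∈-subset⁻ level x∈)

    odd-witness : ∀ {c c′} t → Adj G c c′ → (∀ ℓ → IsLeaf G ℓ → suc (t + t) ≤ dist c ℓ + dist c′ ℓ) →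
                  ∃ λ S → IsKDMV G (suc (t + t)) S × ∣ S ∣ ≡ 2 * suc δ ^ t
    odd-witness {c} {c′} t e leaves-far =
      subset (distanceSum? c c′ k) ,
      distanceSum-visible k (dist-adj e) (subset (distanceSum? c c′ k)) (∈-subset⁻ (distanceSum? c c′ k)) ,
      (begin
        ∣ subset (distanceSum? c c′ k) ∣      ≡⟨ ∣subset∣≡count (distanceSum? c c′ k) ⟩
        count (distanceSum? c c′ k)           ≡⟨ count-edge-split e (distanceSum? c c′ k) ⟩
        At.subtreeCount c (distanceSum? c c′ k) c′ + At.subtreeCount c′ (distanceSum? c c′ k) c
          ≡⟨ cong₂ _+_ (side-count t e leaves-far) (trans swap (side-count t (Adj-sym e) leaves-far′)) ⟩
        suc δ ^ t + suc δ ^ t                 ≡⟨ cong (suc δ ^ t +_) (+-identityʳ (suc δ ^ t)) ⟨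
        2 * suc δ ^ t                         ∎)
      where
      open ≡-Reasoning
      k : ℕ
      k = suc (t + t)
      swap : At.subtreeCount c′ (distanceSum? c c′ k) c ≡
             At.subtreeCount c′ (distanceSum? c′ c k) c
      swap = At.subtreeCount-cong c′ (distanceSum? c c′ k) (distanceSum? c′ c k) c
        (λ x _ sum≡ → trans (+-comm (dist c′ x) (dist c x)) sum≡)
        (λ x _ sum≡ → trans (+-comm (dist c x) (dist c′ x)) sum≡)
      leaves-far′ : ∀ ℓ → IsLeaf G ℓ → k ≤ dist c′ ℓ + dist c ℓ
      leaves-far′ ℓ leaf = ≤-trans (leaves-far ℓ leaf) (≤-reflexive (+-comm (dist c ℓ) (dist c′ ℓ)))

module PerfectTree (G : Graph) (perfect : IsPerfect G) {Δ D : ℕ}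
                   (max-degree : IsMaxDegree G Δ) (diameter : IsDiam G D) (2≤D : 2 ≤ D) where

  tree : IsTree G
  tree = proj₁ (proj₁ perfect)

  open Tree G tree

  dist≤D : ∀ x y → dist x y ≤ D
  dist≤D x y = proj₂ diameter x y (dist x y) (Dist-dist x y)

  opaque
    centre : ∃ λ c → ∀ x → ⊤ → dist c x + dist c x ≤ suc D
    centre = Centre.centre G tree (λ _ → yes tt) D (λ {x} {y} _ _ → dist≤D x y)

  c : V G
  c = proj₁ centre

  open Rooted G tree c

  central : ∀ x → depth x + depth x ≤ suc D
  central x = proj₂ centre x tt

  antipode : ∀ {ℓ} → IsLeaf G ℓ → ∃ λ ℓ′ → D ≡ dist ℓ ℓ′
  antipode {ℓ} leaf with proj₂ (proj₁ perfect) D diameter ℓ leaf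
  ... | ℓ′ , _ , ℓℓ′-dist = ℓ′ , Dist⇒≡dist ℓℓ′-dist

  leaf-depth : ∀ {ℓ} → IsLeaf G ℓ → D ≤ suc (depth ℓ + depth ℓ)
  leaf-depth {ℓ} leaf with antipode leaf
  ... | ℓ′ , D≡ = +-cancelʳ-≤ D D _ (begin
    D + D                                        ≤⟨ +-mono-≤ via-c via-c ⟩
    (depth ℓ + depth ℓ′) + (depth ℓ + depth ℓ′)  ≡⟨ regroup (depth ℓ) (depth ℓ′) ⟩
    (depth ℓ + depth ℓ) + (depth ℓ′ + depth ℓ′)  ≤⟨ +-monoʳ-≤ (depth ℓ + depth ℓ) (central ℓ′) ⟩
    (depth ℓ + depth ℓ) + suc D                  ≡⟨ +-suc (depth ℓ + depth ℓ) D ⟩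
    suc (depth ℓ + depth ℓ) + D                  ∎)
    where
    open ≤-Reasoning
    regroup : ∀ a b → (a + b) + (a + b) ≡ (a + a) + (b + b)
    regroup = solve-∀
    via-c : D ≤ depth ℓ + depth ℓ′
    via-c = ≤-trans (≤-reflexive D≡)
                    (≤-trans (dist-triangle ℓ c ℓ′) (≤-reflexive (cong (_+ depth ℓ′) (dist-sym ℓ c))))

  deepest : V G
  deepest = proj₁ (maximiser depth c)

  depth≤deepest : ∀ x → depth x ≤ depth deepest
  depth≤deepest = proj₂ (maximiser depth c)

  D≤2deepest : D ≤ depth deepest + depth deepest
  D≤2deepest with proj₁ diameter
  ... | x , y , xy-dist = begin
    D                              ≡⟨ Dist⇒≡dist xy-dist ⟩
    dist x y                       ≤⟨ dist-triangle x c y ⟩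
    dist x c + dist c y            ≡⟨ cong (_+ depth y) (dist-sym x c) ⟩
    depth x + depth y              ≤⟨ +-mono-≤ (depth≤deepest x) (depth≤deepest y) ⟩
    depth deepest + depth deepest  ∎
    where open ≤-Reasoning

  c≢deepest : c ≢ deepest
  c≢deepest c≡deepest =
    <⇒≱ 2≤D (≤-trans D≤2deepest (≤-trans (≤-reflexive (cong₂ _+_ root≡0 root≡0)) z≤n))
    where
    root≡0 : depth deepest ≡ 0
    root≡0 = trans (cong depth (sym c≡deepest)) depth-root

  opaque
    toward-deepest : ∃ λ c′ → c ⋖ c′ × c′ ≼ deepest
    toward-deepest = child-toward root≼ c≢deepest

  c′ : V G
  c′ = proj₁ toward-deepest

  c⋖c′ : c ⋖ c′
  c⋖c′ = proj₁ (proj₂ toward-deepest)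

  c′≼deepest : c′ ≼ deepest
  c′≼deepest = proj₂ (proj₂ toward-deepest)

  -- The antipode of a leaf below c′ lies below c′ as well, or else it is separated from
  -- `deepest` by c, which forces the leaf to be at least as deep as `deepest`.
  leaf-depth-below-c′ : ∀ {ℓ} → c′ ≼ ℓ → IsLeaf G ℓ → D ≤ depth ℓ + depth ℓ
  leaf-depth-below-c′ {ℓ} c′≼ℓ leaf with antipode leaf
  ... | ℓ′ , D≡ with c′ ≼? ℓ′
  ...   | yes c′≼ℓ′ =
    ≤-trans (≤-double-larger {dist c′ ℓ} {dist c′ ℓ′} D≤ 2ℓ′<D) (+-mono-≤ ℓ-below ℓ-below)
    where
    ℓ-below : dist c′ ℓ ≤ depth ℓ
    ℓ-below = ≤-trans (n≤1+n _) (≤-reflexive (dist-inside-root-child c⋖c′ c′≼ℓ))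
    D≤ : D ≤ dist c′ ℓ + dist c′ ℓ′
    D≤ = ≤-trans (≤-reflexive D≡)
                 (≤-trans (dist-triangle ℓ c′ ℓ′) (≤-reflexive (cong (_+ dist c′ ℓ′) (dist-sym ℓ c′))))
    2ℓ′<D : suc (dist c′ ℓ′ + dist c′ ℓ′) ≤ D
    2ℓ′<D = s≤s⁻¹ (begin
      suc (suc (dist c′ ℓ′ + dist c′ ℓ′))  ≡⟨ cong suc (+-suc (dist c′ ℓ′) (dist c′ ℓ′)) ⟨
      suc (dist c′ ℓ′) + suc (dist c′ ℓ′)  ≡⟨ cong₂ _+_ (dist-inside-root-child c⋖c′ c′≼ℓ′)
                                                       (dist-inside-root-child c⋖c′ c′≼ℓ′) ⟩
      depth ℓ′ + depth ℓ′                  ≤⟨ central ℓ′ ⟩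
      suc D                                ∎)
      where open ≤-Reasoning
  ...   | no  c′⋠ℓ′ with root-between-or-same-branch ℓ′ deepest
  ...     | inj₂ (w , c⋖w , w≼ℓ′ , w≼deepest) =
    contradiction (subst (_≼ ℓ′) (child-unique c⋖w c⋖c′ w≼deepest c′≼deepest) w≼ℓ′) c′⋠ℓ′
  ...     | inj₁ ℓ′-c-deepest = ≤-trans D≤2deepest (+-mono-≤ deepest≤ℓ deepest≤ℓ)
    where
    deepest≤ℓ : depth deepest ≤ depth ℓ
    deepest≤ℓ = +-cancelˡ-≤ (depth ℓ′) _ _ (begin
      depth ℓ′ + depth deepest   ≡⟨ cong (_+ depth deepest) (dist-sym c ℓ′) ⟩
      dist ℓ′ c + dist c deepest ≡⟨ ℓ′-c-deepest ⟩
      dist ℓ′ deepest            ≤⟨ dist≤D ℓ′ deepest ⟩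
      D                          ≡⟨ D≡ ⟩
      dist ℓ ℓ′                  ≤⟨ dist-triangle ℓ c ℓ′ ⟩
      dist ℓ c + dist c ℓ′       ≡⟨ cong (_+ depth ℓ′) (dist-sym ℓ c) ⟩
      depth ℓ + depth ℓ′         ≡⟨ +-comm (depth ℓ) (depth ℓ′) ⟩
      depth ℓ′ + depth ℓ         ∎)
      where open ≤-Reasoning

  c-internal : ¬ IsLeaf G c
  c-internal leaf =
    <⇒≱ 2≤D (≤-trans (leaf-depth leaf) (≤-reflexive (cong suc (cong₂ _+_ depth-root depth-root))))

  degree≤Δ : ∀ x → degree x ≤ Δ
  degree≤Δ x = subst (_≤ Δ) (deg≡degree x) (proj₂ max-degree x)

  2≤Δ : 2 ≤ Δ
  2≤Δ = ≤-trans (≤∧≢⇒< 1≤degree (c-internal ∘ trans (deg≡degree c) ∘ sym)) (degree≤Δ c)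
    where
    1≤degree : 1 ≤ degree c
    1≤degree = ≤-trans (≤-reflexive (sym (𝟙-yes (Adj? c c′) (proj₁ c⋖c′))))
                       (term≤sum (λ u → 𝟙 (Adj? c u)) c′)

  δ : ℕ
  δ = Δ ∸ 2

  Δ≡ : Δ ≡ suc (suc δ)
  Δ≡ = trans (sym (m∸n+n≡m 2≤Δ)) (+-comm δ 2)

  degree≤ : ∀ x → degree x ≤ suc (suc δ)
  degree≤ x = subst (degree x ≤_) Δ≡ (degree≤Δ x)

  internal-degree : ∀ x → ¬ IsLeaf G x → degree x ≡ suc (suc δ)
  internal-degree x x-internal with proj₁ max-degree
  ... | x₀ , deg-x₀≡Δ = begin
    degree x   ≡⟨ deg≡degree x ⟨
    deg G x    ≡⟨ proj₂ perfect x x₀ x-internal x₀-internal ⟩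
    deg G x₀   ≡⟨ deg-x₀≡Δ ⟩
    Δ          ≡⟨ Δ≡ ⟩
    suc (suc δ) ∎
    where
    open ≡-Reasoning
    x₀-internal : ¬ IsLeaf G x₀
    x₀-internal leaf = <⇒≱ 2≤Δ (≤-reflexive (trans (sym deg-x₀≡Δ) leaf))

  leaves-deep : ∀ h → suc h + suc h ≤ D → ∀ ℓ → IsLeaf G ℓ → suc h + suc h ≤ depth ℓ + depth ℓ
  leaves-deep h k≤D ℓ leaf = +-mono-≤ h<ℓ h<ℓ
    where
    h<ℓ : suc h ≤ depth ℓ
    h<ℓ = half-≤ (suc h) (depth ℓ) (≤-trans k≤D (leaf-depth leaf))

  leaves-far : ∀ t → suc (t + t) ≤ D → ∀ ℓ → IsLeaf G ℓ → suc (t + t) ≤ depth ℓ + dist c′ ℓ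
  leaves-far t k≤D ℓ leaf with c′ ≼? ℓ
  ... | yes c′≼ℓ = ≤-trans (s≤s (+-mono-≤ t≤ t≤))
                           (≤-reflexive (cong (_+ dist c′ ℓ) (dist-inside-root-child c⋖c′ c′≼ℓ)))
    where
    t≤ : t ≤ dist c′ ℓ
    t≤ = half-≤ t (dist c′ ℓ) (s≤s⁻¹ (begin
      suc (t + t)                         ≤⟨ ≤-trans k≤D (leaf-depth-below-c′ c′≼ℓ leaf) ⟩
      depth ℓ + depth ℓ                   ≡⟨ cong₂ _+_ (dist-inside-root-child c⋖c′ c′≼ℓ)
                                                       (dist-inside-root-child c⋖c′ c′≼ℓ) ⟨
      suc (dist c′ ℓ) + suc (dist c′ ℓ)   ≡⟨ cong suc (+-suc (dist c′ ℓ) (dist c′ ℓ)) ⟩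
      suc (suc (dist c′ ℓ + dist c′ ℓ))   ∎))
      where open ≤-Reasoning
  ... | no c′⋠ℓ = ≤-trans k≤D (≤-trans (leaf-depth leaf) (≤-reflexive (sym
                    (trans (cong (depth ℓ +_) (dist-outside-root-child c⋖c′ c′⋠ℓ)) (+-suc (depth ℓ) (depth ℓ))))))

  μ-even : ∀ h → suc h + suc h ≤ D → IsMuK G (suc h + suc h) (suc (suc δ) * suc δ ^ h)
  μ-even h k≤D =
    LowerBound.even-witness G tree δ internal-degree c h (leaves-deep h k≤D) ,
    λ S S-visible → UpperBound.upper-even G tree δ degree≤ h S-visible

  μ-odd : ∀ h → suc (suc h + suc h) ≤ D → IsMuK G (suc (suc h + suc h)) (2 * suc δ ^ suc h)
  μ-odd h k≤D =
    LowerBound.odd-witness G tree δ internal-degree (suc h) (proj₁ c⋖c′) (leaves-far (suc h) k≤D) ,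
    λ S S-visible → UpperBound.upper-odd G tree δ degree≤ h S-visible

corollary4p5 : (G : Graph) → IsPerfect G → (Δ D k : ℕ) →
    IsMaxDegree G Δ → IsDiam G D → 2 ≤ k → k ≤ D →
    (k % 2 ≡ 0 → IsMuK G k (Δ * (Δ ∸ 1) ^ ((k ∸ 2) / 2))) ×
    (k % 2 ≡ 1 → IsMuK G k (2 * (Δ ∸ 1) ^ ((k ∸ 1) / 2)))
corollary4p5 G perfect Δ D k max-degree diameter 2≤k k≤D with even-or-odd k
... | zero  , inj₁ refl = contradiction 2≤k λ ()
... | zero  , inj₂ refl = contradiction 2≤k λ { (s≤s ()) }
... | suc h , inj₁ refl =
  (λ _ → subst (IsMuK G k) (sym μ≡) (μ-even h k≤D)) ,
  (λ k%2≡1 → contradiction (trans (sym (double%2 (suc h))) k%2≡1) λ ())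
  where
  open PerfectTree G perfect max-degree diameter (≤-trans 2≤k k≤D)
  μ≡ : Δ * (Δ ∸ 1) ^ ((k ∸ 2) / 2) ≡ suc (suc δ) * suc δ ^ h
  μ≡ = cong₂ (λ Δ e → Δ * (Δ ∸ 1) ^ e) Δ≡ (trans (cong (λ m → (m ∸ 1) / 2) (+-suc h h)) (double/2 h))
... | suc h , inj₂ refl =
  (λ k%2≡0 → contradiction (trans (sym (suc-double%2 (suc h))) k%2≡0) λ ()) ,
  (λ _ → subst (IsMuK G k) (sym μ≡) (μ-odd h k≤D))
  where
  open PerfectTree G perfect max-degree diameter (≤-trans 2≤k k≤D)
  μ≡ : 2 * (Δ ∸ 1) ^ ((k ∸ 1) / 2) ≡ 2 * suc δ ^ suc h
  μ≡ = cong₂ (λ Δ e → 2 * (Δ ∸ 1) ^ e) Δ≡ (double/2 (suc h))
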